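{- For every $n\ge 4$, $c^3(D_4\square P_n)=10$.
   Context: $P_n$ is the path on $n$ vertices. For $k\ge1$, $D_k$ is the graph obtained from two disjoint cliques $K_k$ by adding a new vertex $v$ and joining $v$ by one edge to one vertex of each clique. $\square$ is the Cartesian product: $(u,v)\sim(u',v')$ iff ($u=u'$ and $vv'$ is an edge of the second factor) or ($v=v'$ and $uu'$ is an edge of the first factor). For a graph $\Gamma$ and integer $g\ge0$, a set $X\subseteq V(\Gamma)$ is a $g$-good-neighbor cut if $\Gamma-X$ is disconnected and every vertex outside $X$ has at least $g$ neighbors outside $X$. For such $X$ and a component $C$ of $\Gamma-X$, $C$ is splittable if $V(C)$ partitions into nonempty $A,B$ with $\delta(\Gamma[A]),\delta(\Gamma[B])\ge g$; among such partitions with $|A|\ge|B|$ minimizing $|A|-|B|$ set $a(C)=|A|$. $a(X)=\min a(C)$ over splittable components, $c(X)=$ minimum order of a non-splittable component (minima over empty sets $+\infty$), and the gc number is $c^g(\Gamma)=\min_X\{|X|+\min\{a(X),c(X)\}\}$ over all $g$-good-neighbor cuts $X$. -}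

module Defs where

open import Data.Nat using (ℕ; zero; suc; _+_; _*_; _≤_)
open import Data.Bool using (Bool; true; false; _∧_; _∨_; T)
open import Data.Fin using (Fin; toℕ; remQuot; _≟_)
open import Data.Fin.Subset using (Subset; _∈_; _∉_; _∩_; _∪_; ∁; ∣_∣; Empty)
open import Data.Vec using (tabulate)
open import Data.Product using (Σ; ∃; ∃-syntax; _×_; _,_)
open import Data.Sum using (_⊎_)
open import Relation.Nullary using (¬_)
open import Relation.Nullary.Decidable using (⌊_⌋)
open import Relation.Binary.PropositionalEquality using (_≡_)
open import Function.Bundles using (_⇔_)

record Graph : Set where
  field
    N   : ℕ
    adj : Fin N → Fin N → Bool

open Graph public

Adj : (Γ : Graph) → Fin (N Γ) → Fin (N Γ) → Set
Adj Γ u v = T (adj Γ u v)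

nbhd : (Γ : Graph) → Fin (N Γ) → Subset (N Γ)
nbhd Γ v = tabulate (adj Γ v)

natEq : ℕ → ℕ → Bool
natEq zero    zero    = true
natEq zero    (suc _) = false
natEq (suc _) zero    = false
natEq (suc m) (suc n) = natEq m n

P : ℕ → Graph
P n = record { N = n ; adj = λ i j → natEq (suc (toℕ i)) (toℕ j) ∨ natEq (suc (toℕ j)) (toℕ i) }

-- D_k on 2k+1 vertices: vertices 0..k-1 form a clique K_k, vertices k..2k-1
-- form a second clique K_k, vertex 2k is the new vertex v, adjacent to
-- vertex 0 (of the first clique) and vertex k (of the second clique).
D : ℕ → Graph
D k = record { N = suc (k + k) ; adj = λ i j → a (toℕ i) (toℕ j) }
  where
  lt : ℕ → ℕ → Bool
  lt _       zero    = false
  lt zero    (suc _) = true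
  lt (suc m) (suc n) = lt m n
  inC1 inC2 : ℕ → Bool
  inC1 x = lt x k
  inC2 x = Data.Bool.not (lt x k) ∧ lt x (k + k)
  isV : ℕ → Bool
  isV x = natEq x (k + k)
  a : ℕ → ℕ → Bool
  a x y = (Data.Bool.not (natEq x y) ∧ ((inC1 x ∧ inC1 y) ∨ (inC2 x ∧ inC2 y)))
        ∨ (isV x ∧ (natEq y 0 ∨ natEq y k))
        ∨ (isV y ∧ (natEq x 0 ∨ natEq x k))

-- Cartesian product Γ □ Δ on Fin (N Γ * N Δ); a vertex i is identified with
-- the pair remQuot (N Δ) i : Fin (N Γ) × Fin (N Δ) (a bijection).
_□_ : Graph → Graph → Graph
Γ □ Δ = record { N = N Γ * N Δ ; adj = a }
  where
  a : Fin (N Γ * N Δ) → Fin (N Γ * N Δ) → Bool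
  a x y with remQuot {N Γ} (N Δ) x | remQuot {N Γ} (N Δ) y
  ... | (u , v) | (u' , v') = (⌊ u ≟ u' ⌋ ∧ adj Δ v v') ∨ (⌊ v ≟ v' ⌋ ∧ adj Γ u u')

module _ (Γ : Graph) where

  V = Fin (N Γ)

  MinDegGE : Subset (N Γ) → ℕ → Set
  MinDegGE S g = ∀ v → v ∈ S → g ≤ ∣ nbhd Γ v ∩ S ∣

  data Reach (S : Subset (N Γ)) (u : V) : V → Set where
    here : u ∈ S → Reach S u u
    step : ∀ {w v} → Reach S u w → Adj Γ w v → v ∈ S → Reach S u v

  DisconnectedAfter : Subset (N Γ) → Set
  DisconnectedAfter X = ∃[ u ] ∃[ v ] (u ∉ X × v ∉ X × ¬ Reach (∁ X) u v)

  GoodNeighborCut : ℕ → Subset (N Γ) → Set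
  GoodNeighborCut g X = DisconnectedAfter X × MinDegGE (∁ X) g

  Component : Subset (N Γ) → Subset (N Γ) → Set
  Component X C = ∃[ u ] (u ∉ X × (∀ v → (v ∈ C) ⇔ Reach (∁ X) u v))

  Split : ℕ → Subset (N Γ) → Subset (N Γ) → Subset (N Γ) → Set
  Split g C A B =
    (∀ v → (v ∈ C) ⇔ (v ∈ A ⊎ v ∈ B)) × Empty (A ∩ B) ×
    ¬ Empty A × ¬ Empty B × MinDegGE A g × MinDegGE B g

  Splittable : ℕ → Subset (N Γ) → Set
  Splittable g C = ∃[ A ] ∃[ B ] Split g C A B

  -- a(C) = k : among splits (A,B) with |A| ≥ |B| minimizing |A| - |B|,
  -- |A| = k.  (Since |A| + |B| = |C|, minimizing |A| - |B| subject to
  -- |A| ≥ |B| is the same as minimizing |A|.)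
  IsA : ℕ → Subset (N Γ) → ℕ → Set
  IsA g C k =
    (∃[ A ] ∃[ B ] (Split g C A B × ∣ B ∣ ≤ ∣ A ∣ × ∣ A ∣ ≡ k)) ×
    (∀ A B → Split g C A B → ∣ B ∣ ≤ ∣ A ∣ → k ≤ ∣ A ∣)

  CompVal : ℕ → Subset (N Γ) → ℕ → Set
  CompVal g C k = (Splittable g C × IsA g C k) ⊎ (¬ Splittable g C × k ≡ ∣ C ∣)

  MinAC : ℕ → Subset (N Γ) → ℕ → Set
  MinAC g X k =
    (∃[ C ] (Component X C × CompVal g C k)) ×
    (∀ C k' → Component X C → CompVal g C k' → k ≤ k')

  GCNumber : ℕ → ℕ → Set
  GCNumber g m =
    (∃[ X ] ∃[ k ] (GoodNeighborCut g X × MinAC g X k × m ≡ ∣ X ∣ + k)) ×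
    (∀ X k → GoodNeighborCut g X → MinAC g X k → m ≤ ∣ X ∣ + k)

{-# OPTIONS --safe #-}
-- Upper bound: layer 1 of the first clique together with the apex in layers 0 and 1 is a 3-good-neighbour
-- cut of six vertices which cuts off layer 0 of the first clique, a K₄; a vertex set of minimum degree 3 has
-- at least four vertices, so this K₄ cannot be split, and 6 + 4 = 10 is attained.
-- Lower bound: every component of Γ − X and every part of a split have at least four vertices, which settles
-- |X| ≥ 6. A 3-good cut with |X| ≤ 5 contains the whole apex column. Otherwise, either both cliques have a
-- column avoiding X, and the lowest apex vertex outside X has both hubs outside X and links the cliques, so
-- Γ − X is connected; or some clique meets X in all four of its columns, leaving at most one vertex of X
-- elsewhere, and a vertex of that clique cut off from the rest forces, through the degree condition, either a
-- sixth vertex into X or an apex vertex with only two neighbours outside X. Once the apex column lies in X,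
-- n ≥ 4 gives |X| ≥ 4, each clique keeps a column avoiding X, and a component contains all free cells of its
-- clique; the first four layers give |C| + |X| ≥ 16, while a(C) ≥ |C|/2, hence |X| + a ≥ 10.

module Submission where

open import Defs
open import Data.Bool using (Bool; T; not; _∧_; _∨_)
open import Data.Bool.Properties using (T-≡; T-∧; T-∨) renaming (_≟_ to _≟ᵇ_)
open import Data.Empty using (⊥; ⊥-elim)
open import Data.Fin using (Fin; zero; suc; toℕ; fromℕ; fromℕ<; inject₁; combine; remQuot; opposite; _↑ˡ_; #_; _≟_)
open import Data.Fin.Properties
  using (all?; any?; ¬∀⟶∃¬; toℕ-injective; toℕ-fromℕ<; toℕ-inject₁; combine-injective; combine-remQuot; remQuot-combine;
         ↑ˡ-injective)
open import Data.Fin.Subset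
  using (Subset; _∈_; _∉_; _∩_; _∪_; _-_; _⊆_; ∁; ∣_∣; Empty; Nonempty; ⁅_⁆; inside; outside) renaming (⊥ to ∅)
open import Data.Fin.Subset.Properties
  using (_∈?_; p⊆q⇒∣p∣≤∣q∣; x∈p∪q⁺; x∈p∪q⁻; x∈p∩q⁺; x∈p∩q⁻; x∈⁅x⁆; x∈⁅y⁆⇒x≡y; ∉⊥; ∣⁅x⁆∣≡1; x∈p∧x≢y⇒x∈p-y; p─q⊆p;
         nonempty?; Empty-unique; ∣⊥∣≡0; x∈p⇒∣p-x∣<∣p∣; x∉p⇒x∈∁p; x∈∁p⇒x∉p)
open import Data.List using (List; []; _∷_; _++_; length; foldr; tabulate)
open import Data.List.Properties using (length-tabulate)
open import Data.List.Membership.Propositional using () renaming (_∈_ to _∈ₗ_)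
open import Data.List.Membership.Propositional.Properties using (∈-++⁺ˡ; ∈-++⁺ʳ; ∈-++⁻; ∈-tabulate⁺; ∈-tabulate⁻)
open import Data.List.Relation.Unary.All as All using (All; []; _∷_)
import Data.List.Relation.Unary.All.Properties as Allₚ
open import Data.List.Relation.Unary.AllPairs using ([]; _∷_)
open import Data.List.Relation.Unary.Any using (here; there)
open import Data.List.Relation.Unary.Unique.Propositional using (Unique)
import Data.List.Relation.Unary.Unique.Propositional.Properties as Unique
open import Data.Nat using (ℕ; zero; suc; _+_; _*_; _≤_; _<_; z≤n; s≤s; _≤?_; _<?_)
open import Data.Nat.Properties
  using (suc-injective; 1+n≢0; 1+n≢n; n≤1+n; m≤m+n; ≤-reflexive; ≤-trans; ≤-antisym; ≤-pred; <-irrefl; ≮⇒≥; <⇒≱; ≰⇒>;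
         +-suc; +-mono-≤; +-monoʳ-≤; +-monoˡ-≤; +-mono-<; module ≤-Reasoning)
  renaming (_≟_ to _≟ℕ_)
open import Data.Nat.Tactic.RingSolver using (solve-∀)
open import Data.Product using (∃; ∃₂; _×_; _,_; proj₁; proj₂)
open import Data.Sum using (_⊎_; inj₁; inj₂; [_,_]; swap; map)
open import Data.Unit using (tt)
import Data.Vec
open import Data.Vec using (_∷_; [])
open import Data.Vec.Properties using (lookup∘tabulate; []=⇒lookup; lookup⇒[]=)
open import Function using (id; _∘_)
open import Function.Bundles using (Equivalence; _⇔_; mk⇔)
open import Relation.Nullary using (¬_; Dec; yes; no; contradiction)
open import Relation.Nullary.Decidable
  using (⌊_⌋; toWitness; toWitnessFalse; fromWitness; fromWitnessFalse; decidable-stable; ¬?; _→-dec_; _⊎-dec_; _×-dec_)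
open import Relation.Binary.PropositionalEquality using (_≡_; _≢_; refl; sym; trans; cong; cong₂; subst; ≢-sym)

open Equivalence using (to; from)

-- Counting in finite subsets

Subsingleton : {A : Set} → (A → Set) → Set
Subsingleton P = ∀ {x y} → P x → P y → x ≡ y

≡-subsingleton : ∀ {A : Set} {a : A} → Subsingleton (_≡ a)
≡-subsingleton x≡a y≡a = trans x≡a (sym y≡a)

x∉p-x : ∀ {m} (p : Subset m) x → x ∉ p - x
x∉p-x (_ ∷ p) (suc x) (Data.Vec.there x∈p-x) = x∉p-x p x x∈p-x

x∈p-y⇒x≢y : ∀ {m} {p : Subset m} {x y} → x ∈ p - y → x ≢ y
x∈p-y⇒x≢y {p = p} {x} x∈p-x refl = x∉p-x p x x∈p-x

Empty⇒∣p∣≡0 : ∀ {m} {p : Subset m} → Empty p → ∣ p ∣ ≡ 0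
Empty⇒∣p∣≡0 {m} p-empty = trans (cong ∣_∣ (Empty-unique p-empty)) (∣⊥∣≡0 m)

¬Empty⇒Nonempty : ∀ {m} {p : Subset m} → ¬ Empty p → Nonempty p
¬Empty⇒Nonempty {p = p} = decidable-stable (nonempty? p)

∣p∪q∣≤∣p∣+∣q∣ : ∀ {m} (p q : Subset m) → ∣ p ∪ q ∣ ≤ ∣ p ∣ + ∣ q ∣
∣p∪q∣≤∣p∣+∣q∣ []            []            = z≤n
∣p∪q∣≤∣p∣+∣q∣ (outside ∷ p) (outside ∷ q) = ∣p∪q∣≤∣p∣+∣q∣ p q
∣p∪q∣≤∣p∣+∣q∣ (inside ∷ p)  (outside ∷ q) = s≤s (∣p∪q∣≤∣p∣+∣q∣ p q)
∣p∪q∣≤∣p∣+∣q∣ (outside ∷ p) (inside ∷ q)  =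
  ≤-trans (s≤s (∣p∪q∣≤∣p∣+∣q∣ p q)) (≤-reflexive (sym (+-suc ∣ p ∣ ∣ q ∣)))
∣p∪q∣≤∣p∣+∣q∣ (inside ∷ p)  (inside ∷ q)  =
  s≤s (≤-trans (∣p∪q∣≤∣p∣+∣q∣ p q) (+-monoʳ-≤ ∣ p ∣ (n≤1+n ∣ q ∣)))

∣p∣≤1+∣p-x∣ : ∀ {m} (p : Subset m) x → ∣ p ∣ ≤ suc ∣ p - x ∣
∣p∣≤1+∣p-x∣ p x = begin
  ∣ p ∣                  ≤⟨ p⊆q⇒∣p∣≤∣q∣ p⊆⁅x⁆∪p-x ⟩
  ∣ ⁅ x ⁆ ∪ (p - x) ∣    ≤⟨ ∣p∪q∣≤∣p∣+∣q∣ ⁅ x ⁆ (p - x) ⟩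
  ∣ ⁅ x ⁆ ∣ + ∣ p - x ∣  ≡⟨ cong (_+ ∣ p - x ∣) (∣⁅x⁆∣≡1 x) ⟩
  suc ∣ p - x ∣          ∎
  where
  open ≤-Reasoning
  p⊆⁅x⁆∪p-x : p ⊆ ⁅ x ⁆ ∪ (p - x)
  p⊆⁅x⁆∪p-x {y} y∈p with y ≟ x
  ... | yes refl = x∈p∪q⁺ (inj₁ (x∈⁅x⁆ x))
  ... | no y≢x   = x∈p∪q⁺ (inj₂ (x∈p∧x≢y⇒x∈p-y y∈p y≢x))

∣p∣≤1 : ∀ {m} {p : Subset m} {P : Fin m → Set} →
        Subsingleton P → (∀ {x} → x ∈ p → P x) → ∣ p ∣ ≤ 1
∣p∣≤1 {m} {p} P-sub p⊆P with nonempty? p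
... | no p-empty = subst (_≤ 1) (sym (Empty⇒∣p∣≡0 p-empty)) z≤n
... | yes (x , x∈p) = ≤-trans (p⊆q⇒∣p∣≤∣q∣ p⊆⁅x⁆) (≤-reflexive (∣⁅x⁆∣≡1 x))
  where
  p⊆⁅x⁆ : p ⊆ ⁅ x ⁆
  p⊆⁅x⁆ y∈p = subst (_∈ ⁅ x ⁆) (P-sub (p⊆P x∈p) (p⊆P y∈p)) (x∈⁅x⁆ x)

∣p∣≤2 : ∀ {m} {p : Subset m} {P Q : Fin m → Set} →
        Subsingleton P → Subsingleton Q → (∀ {x} → x ∈ p → P x ⊎ Q x) → ∣ p ∣ ≤ 2
∣p∣≤2 {m} {p} {P} {Q} P-sub Q-sub p⊆P∪Q with nonempty? p
... | no p-empty = subst (_≤ 2) (sym (Empty⇒∣p∣≡0 p-empty)) z≤n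
... | yes (x , x∈p) = ≤-trans (∣p∣≤1+∣p-x∣ p x) (s≤s (rest (p⊆P∪Q x∈p)))
  where
  rest : P x ⊎ Q x → ∣ p - x ∣ ≤ 1
  rest (inj₁ Px) = ∣p∣≤1 Q-sub λ y∈p-x →
    [ (λ Py → contradiction (P-sub Py Px) (x∈p-y⇒x≢y y∈p-x)) , id ] (p⊆P∪Q (p─q⊆p p ⁅ x ⁆ y∈p-x))
  rest (inj₂ Qx) = ∣p∣≤1 P-sub λ y∈p-x →
    [ id , (λ Qy → contradiction (Q-sub Qy Qx) (x∈p-y⇒x≢y y∈p-x)) ] (p⊆P∪Q (p─q⊆p p ⁅ x ⁆ y∈p-x))

length≤∣p∣ : ∀ {m} {p : Subset m} {xs : List (Fin m)} → Unique xs → All (_∈ p) xs → length xs ≤ ∣ p ∣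
length≤∣p∣ [] [] = z≤n
length≤∣p∣ {p = p} {x ∷ xs} (x∉xs ∷ xs-unique) (x∈p ∷ xs⊆p) =
  ≤-trans (s≤s (length≤∣p∣ xs-unique (All.zipWith xs⊆p-x (x∉xs , xs⊆p)))) (x∈p⇒∣p-x∣<∣p∣ x∈p)
  where
  xs⊆p-x : ∀ {y} → x ≢ y × y ∈ p → y ∈ p - x
  xs⊆p-x (x≢y , y∈p) = x∈p∧x≢y⇒x∈p-y y∈p (≢-sym x≢y)

fromList : ∀ {m} → List (Fin m) → Subset m
fromList = foldr (λ x p → ⁅ x ⁆ ∪ p) ∅

∈-fromList⁺ : ∀ {m} {x : Fin m} xs → x ∈ₗ xs → x ∈ fromList xs
∈-fromList⁺ (x ∷ _)  (here refl)  = x∈p∪q⁺ (inj₁ (x∈⁅x⁆ x))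
∈-fromList⁺ (_ ∷ xs) (there x∈xs) = x∈p∪q⁺ (inj₂ (∈-fromList⁺ xs x∈xs))

∈-fromList⁻ : ∀ {m} {x : Fin m} xs → x ∈ fromList xs → x ∈ₗ xs
∈-fromList⁻ []       x∈⊥ = contradiction x∈⊥ ∉⊥
∈-fromList⁻ (y ∷ ys) x∈ with x∈p∪q⁻ ⁅ y ⁆ (fromList ys) x∈
... | inj₁ x∈⁅y⁆ = here (x∈⁅y⁆⇒x≡y y x∈⁅y⁆)
... | inj₂ x∈ys  = there (∈-fromList⁻ ys x∈ys)

∣fromList∣≤length : ∀ {m} (xs : List (Fin m)) → ∣ fromList xs ∣ ≤ length xs
∣fromList∣≤length {m} []       = ≤-reflexive (∣⊥∣≡0 m)
∣fromList∣≤length     (x ∷ xs) = begin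
  ∣ ⁅ x ⁆ ∪ fromList xs ∣           ≤⟨ ∣p∪q∣≤∣p∣+∣q∣ ⁅ x ⁆ (fromList xs) ⟩
  ∣ ⁅ x ⁆ ∣ + ∣ fromList xs ∣       ≡⟨ cong (_+ ∣ fromList xs ∣) (∣⁅x⁆∣≡1 x) ⟩
  suc ∣ fromList xs ∣               ≤⟨ s≤s (∣fromList∣≤length xs) ⟩
  suc (length xs)                   ∎
  where open ≤-Reasoning

-- Good-neighbour cuts in an arbitrary graph

module GoodNeighbourCuts (Γ : Graph)
    (Adj-sym : ∀ {u v} → Adj Γ u v → Adj Γ v u)
    (Adj-irrefl : ∀ {u} → ¬ Adj Γ u u) where

  private
    variable
      u v w : Fin (N Γ)
      g k : ℕ
      S X C A B : Subset (N Γ)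

  Adj⇒∈nbhd : Adj Γ u v → v ∈ nbhd Γ u
  Adj⇒∈nbhd {u} {v} u~v =
    lookup⇒[]= v (nbhd Γ u) (trans (lookup∘tabulate (adj Γ u) v) (to T-≡ u~v))

  ∈nbhd⇒Adj : v ∈ nbhd Γ u → Adj Γ u v
  ∈nbhd⇒Adj {v} {u} v∈N = from T-≡ (trans (sym (lookup∘tabulate (adj Γ u) v)) ([]=⇒lookup v∈N))

  Reach-end : Reach Γ S u v → v ∈ S
  Reach-end (here v∈S)     = v∈S
  Reach-end (step _ _ v∈S) = v∈S

  Reach-trans : Reach Γ S u w → Reach Γ S w v → Reach Γ S u v
  Reach-trans r (here _)           = r
  Reach-trans r (step r′ w~v v∈S) = step (Reach-trans r r′) w~v v∈S

  Reach-edge : u ∈ S → Adj Γ u v → v ∈ S → Reach Γ S u v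
  Reach-edge u∈S = step (here u∈S)

  Reach-sym : Reach Γ S u v → Reach Γ S v u
  Reach-sym (here v∈S)       = here v∈S
  Reach-sym (step r w~v v∈S) = Reach-trans (Reach-edge v∈S (Adj-sym w~v) (Reach-end r)) (Reach-sym r)

  minDeg⇒g<∣S∣ : MinDegGE Γ S g → u ∈ S → g < ∣ S ∣
  minDeg⇒g<∣S∣ {S} {g} {u} δ≥g u∈S = begin
    suc g                  ≤⟨ s≤s (δ≥g u u∈S) ⟩
    suc ∣ nbhd Γ u ∩ S ∣   ≤⟨ s≤s (p⊆q⇒∣p∣≤∣q∣ N∩S⊆S-u) ⟩
    suc ∣ S - u ∣          ≤⟨ x∈p⇒∣p-x∣<∣p∣ u∈S ⟩
    ∣ S ∣                  ∎
    where
    open ≤-Reasoning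
    N∩S⊆S-u : nbhd Γ u ∩ S ⊆ S - u
    N∩S⊆S-u v∈N∩S with x∈p∩q⁻ (nbhd Γ u) S v∈N∩S
    ... | v∈N , v∈S = x∈p∧x≢y⇒x∈p-y v∈S λ { refl → Adj-irrefl (∈nbhd⇒Adj v∈N) }

  component-minDeg : MinDegGE Γ (∁ X) g → Component Γ X C → MinDegGE Γ C g
  component-minDeg {X} {g} {C} δ≥g (r , _ , C≡reach) v v∈C =
    ≤-trans (δ≥g v (Reach-end r⇝v)) (p⊆q⇒∣p∣≤∣q∣ N∩∁X⊆N∩C)
    where
    r⇝v : Reach Γ (∁ X) r v
    r⇝v = to (C≡reach v) v∈C
    N∩∁X⊆N∩C : nbhd Γ v ∩ ∁ X ⊆ nbhd Γ v ∩ C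
    N∩∁X⊆N∩C {w} w∈N∩∁X with x∈p∩q⁻ (nbhd Γ v) (∁ X) w∈N∩∁X
    ... | w∈N , w∉X = x∈p∩q⁺ (w∈N , from (C≡reach w) (step r⇝v (∈nbhd⇒Adj w∈N) w∉X))

  compVal⇒g<k : MinDegGE Γ (∁ X) g → Component Γ X C → CompVal Γ g C k → g < k
  compVal⇒g<k δ≥g C-comp (inj₁ (_ , (A , B , (_ , _ , A≠∅ , _ , δA≥g , _) , _ , refl) , _)) =
    let (a , a∈A) = ¬Empty⇒Nonempty A≠∅ in minDeg⇒g<∣S∣ δA≥g a∈A
  compVal⇒g<k δ≥g C-comp@(r , r∉X , C≡reach) (inj₂ (_ , refl)) =
    minDeg⇒g<∣S∣ (component-minDeg δ≥g C-comp) (from (C≡reach r) (here (x∉p⇒x∈∁p r∉X)))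

  ∣C∣≤k+k : CompVal Γ g C k → ∣ C ∣ ≤ k + k
  ∣C∣≤k+k {C = C} (inj₁ (_ , (A , B , (C≡A∪B , _) , ∣B∣≤∣A∣ , refl) , _)) = begin
    ∣ C ∣           ≤⟨ p⊆q⇒∣p∣≤∣q∣ (λ v∈C → x∈p∪q⁺ (to (C≡A∪B _) v∈C)) ⟩
    ∣ A ∪ B ∣       ≤⟨ ∣p∪q∣≤∣p∣+∣q∣ A B ⟩
    ∣ A ∣ + ∣ B ∣   ≤⟨ +-monoʳ-≤ ∣ A ∣ ∣B∣≤∣A∣ ⟩
    ∣ A ∣ + ∣ A ∣   ∎
    where open ≤-Reasoning
  ∣C∣≤k+k {C = C} (inj₂ (_ , refl)) = m≤m+n ∣ C ∣ ∣ C ∣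

  Split⇒1+g<∣C∣ : Split Γ g C A B → suc g < ∣ C ∣
  Split⇒1+g<∣C∣ {g} {C} {A} {B} (C≡A⊎B , A∩B≡∅ , A≢∅ , B≢∅ , δA≥g , _) = begin
    suc (suc g)     ≤⟨ s≤s (minDeg⇒g<∣S∣ δA≥g (proj₂ (¬Empty⇒Nonempty A≢∅))) ⟩
    suc ∣ A ∣       ≤⟨ s≤s (p⊆q⇒∣p∣≤∣q∣ A⊆C-b) ⟩
    suc ∣ C - b ∣   ≤⟨ x∈p⇒∣p-x∣<∣p∣ (from (C≡A⊎B b) (inj₂ b∈B)) ⟩
    ∣ C ∣           ∎
    where
    open ≤-Reasoning
    b : Fin (N Γ)
    b = proj₁ (¬Empty⇒Nonempty B≢∅)
    b∈B : b ∈ B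
    b∈B = proj₂ (¬Empty⇒Nonempty B≢∅)
    A⊆C-b : A ⊆ C - b
    A⊆C-b {v} v∈A = x∈p∧x≢y⇒x∈p-y (from (C≡A⊎B v) (inj₁ v∈A))
      λ { refl → A∩B≡∅ (v , x∈p∩q⁺ (v∈A , b∈B)) }

  ∣nbhd∩∁X∣≤2 : ∀ {P Q : Fin (N Γ) → Set} → Subsingleton P → Subsingleton Q →
                (∀ {v} → Adj Γ u v → v ∉ X → P v ⊎ Q v) → ∣ nbhd Γ u ∩ ∁ X ∣ ≤ 2
  ∣nbhd∩∁X∣≤2 {u} {X} P-sub Q-sub cover = ∣p∣≤2 P-sub Q-sub λ v∈N∩∁X →
    let (v∈N , v∈∁X) = x∈p∩q⁻ (nbhd Γ u) (∁ X) v∈N∩∁X in cover (∈nbhd⇒Adj v∈N) (x∈∁p⇒x∉p v∈∁X)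

-- Layers: the path Pₙ

private
  Consecutiveℕ : ℕ → ℕ → Set
  Consecutiveℕ a b = suc a ≡ b ⊎ suc b ≡ a

_⋖_ : ∀ {n} → Fin n → Fin n → Set
i ⋖ j = suc (toℕ i) ≡ toℕ j

Consecutive : ∀ {n} → Fin n → Fin n → Set
Consecutive i j = i ⋖ j ⊎ j ⋖ i

predecessor : ∀ {n} (i : Fin n) → 0 < toℕ i → ∃ λ j → j ⋖ i
predecessor (suc i) _ = inject₁ i , cong suc (toℕ-inject₁ i)

module _ {n : ℕ} where

  private
    variable
      i j p q r : Fin n

  Consecutive-sym : Consecutive i j → Consecutive j i
  Consecutive-sym (inj₁ e) = inj₂ e
  Consecutive-sym (inj₂ e) = inj₁ e

  Consecutive⇒≢ : Consecutive i j → i ≢ j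
  Consecutive⇒≢ (inj₁ e) refl = 1+n≢n e
  Consecutive⇒≢ (inj₂ e) refl = 1+n≢n e

  consecutive? : ∀ (i j : Fin n) → Dec (Consecutive i j)
  consecutive? i j = (suc (toℕ i) ≟ℕ toℕ j) ⊎-dec (suc (toℕ j) ≟ℕ toℕ i)

  ⋖-functional : Subsingleton (i ⋖_)
  ⋖-functional i⋖j i⋖k = toℕ-injective (trans (sym i⋖j) i⋖k)

  ⋖-injective : Subsingleton (_⋖ i)
  ⋖-injective j⋖i k⋖i = toℕ-injective (suc-injective (trans j⋖i (sym k⋖i)))

  no-triangle : Consecutive p q → Consecutive q r → ¬ Consecutive p r
  no-triangle = go
    where
    go : ∀ {a b c} → Consecutiveℕ a b → Consecutiveℕ b c → ¬ Consecutiveℕ a c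
    go (inj₁ refl) (inj₁ refl) (inj₁ ())
    go (inj₁ refl) (inj₁ refl) (inj₂ ())
    go (inj₁ refl) (inj₂ refl) (inj₁ ())
    go (inj₁ refl) (inj₂ refl) (inj₂ ())
    go (inj₂ refl) (inj₁ refl) (inj₁ ())
    go (inj₂ refl) (inj₁ refl) (inj₂ ())
    go (inj₂ refl) (inj₂ refl) (inj₁ ())
    go (inj₂ refl) (inj₂ refl) (inj₂ ())

  other-neighbour-unique : Consecutive q p → Subsingleton (λ k → Consecutive q k × k ≢ p)
  other-neighbour-unique q~p (q~k , k≢p) (q~k′ , k′≢p) =
    toℕ-injective (go q~p q~k q~k′ (λ e → k≢p (toℕ-injective e)) (λ e → k′≢p (toℕ-injective e)))
    where
    go : ∀ {c a b b′} → Consecutiveℕ c a → Consecutiveℕ c b → Consecutiveℕ c b′ → b ≢ a → b′ ≢ a → b ≡ b′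
    go _           (inj₁ refl) (inj₁ refl) _   _    = refl
    go _           (inj₂ e)    (inj₂ e′)   _   _    = suc-injective (trans e (sym e′))
    go (inj₁ refl) (inj₁ refl) (inj₂ _)    b≢a _    = contradiction refl b≢a
    go (inj₂ e)    (inj₁ refl) (inj₂ e′)   _   b′≢a = contradiction (suc-injective (trans e′ (sym e))) b′≢a
    go (inj₁ refl) (inj₂ _)    (inj₁ refl) _   b′≢a = contradiction refl b′≢a
    go (inj₂ e)    (inj₂ e′)   (inj₁ refl) b≢a _    = contradiction (suc-injective (trans e′ (sym e))) b≢a

  successor : ∀ (i : Fin n) → suc (toℕ i) < n → ∃ λ j → i ⋖ j
  successor i i+1<n = fromℕ< i+1<n , sym (toℕ-fromℕ< i+1<n)

  ∃-consecutive : 2 ≤ n → ∀ (i : Fin n) → ∃ (Consecutive i)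
  ∃-consecutive 2≤n zero    = let (j , e) = successor zero 2≤n in j , inj₁ e
  ∃-consecutive _   (suc i) = let (j , e) = predecessor (suc i) (s≤s z≤n) in j , inj₂ e

  private
    two-steps-≢ : ∀ {a b c : ℕ} → suc a ≡ b → suc b ≡ c → a ≢ c
    two-steps-≢ refl refl ()

    extend-upward : 3 ≤ n → i ⋖ j →
                    ∃ λ (r : Fin n) → (Consecutive j r × r ≢ i) ⊎ (Consecutive i r × r ≢ j)
    extend-upward {i} {j} 3≤n i+1≡j with suc (toℕ j) <? n
    ... | yes j+1<n = let (r , j+1≡r) = successor j j+1<n in
      r , inj₁ (inj₁ j+1≡r , λ r≡i → two-steps-≢ i+1≡j j+1≡r (cong toℕ (sym r≡i)))
    ... | no j+1≮n = let (r , r+1≡i) = predecessor i (0<i i+1≡j j+1≮n) in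
      r , inj₂ (inj₂ r+1≡i , λ r≡j → two-steps-≢ r+1≡i i+1≡j (cong toℕ r≡j))
      where
      0<i : ∀ {a b} → suc a ≡ b → ¬ (suc b < n) → 0 < a
      0<i {zero}  refl b+1≮n = contradiction 3≤n b+1≮n
      0<i {suc a} _    _     = s≤s z≤n

  ∃-extension : 3 ≤ n → Consecutive i j →
                ∃ λ (r : Fin n) → (Consecutive j r × r ≢ i) ⊎ (Consecutive i r × r ≢ j)
  ∃-extension 3≤n (inj₁ i+1≡j) = extend-upward 3≤n i+1≡j
  ∃-extension 3≤n (inj₂ j+1≡i) with extend-upward 3≤n j+1≡i
  ... | r , inj₁ i~r∧r≢j = r , inj₂ i~r∧r≢j
  ... | r , inj₂ j~r∧r≢i = r , inj₁ j~r∧r≢i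

  far-neighbour : 4 ≤ n → ∀ (i : Fin n) → 2 ≤ toℕ i → ∃ λ k → Consecutive i k × 2 ≤ toℕ k
  far-neighbour 4≤n i 2≤i with suc (toℕ i) <? n
  ... | yes i+1<n = let (k , i⋖k) = successor i i+1<n in k , inj₁ i⋖k , ≤-trans 2≤i (subst (toℕ i ≤_) i⋖k (n≤1+n _))
  ... | no  i+1≮n = let (k , k⋖i) = predecessor i (≤-trans (s≤s z≤n) 2≤i) in
    k , inj₂ k⋖i , ≤-pred (subst (3 ≤_) (sym k⋖i) (≤-pred (≤-trans 4≤n (≮⇒≥ i+1≮n))))

natEq⇒≡ : ∀ a b → T (natEq a b) → a ≡ b
natEq⇒≡ zero    zero    _ = refl
natEq⇒≡ (suc a) (suc b) h = cong suc (natEq⇒≡ a b h)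

natEq-refl : ∀ a → T (natEq a a)
natEq-refl zero    = tt
natEq-refl (suc a) = natEq-refl a

module _ {n : ℕ} {i j : Fin n} where

  P-Adj⇒Consecutive : Adj (P n) i j → Consecutive i j
  P-Adj⇒Consecutive i~j with to T-∨ i~j
  ... | inj₁ up   = inj₁ (natEq⇒≡ _ _ up)
  ... | inj₂ down = inj₂ (natEq⇒≡ _ _ down)

  Consecutive⇒P-Adj : Consecutive i j → Adj (P n) i j
  Consecutive⇒P-Adj (inj₁ up)   = from T-∨ (inj₁ (subst (T ∘ natEq (suc (toℕ i))) up (natEq-refl (suc (toℕ i)))))
  Consecutive⇒P-Adj (inj₂ down) =
    from (T-∨ {natEq (suc (toℕ i)) (toℕ j)}) (inj₂ (subst (T ∘ natEq (suc (toℕ j))) down (natEq-refl (suc (toℕ j)))))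

-- The graph D₄

-- apex is the vertex v of D₄ and hub c the vertex of clique c joined to it.
data D4-Vertex : Set where
  clique : Fin 2 → Fin 4 → D4-Vertex
  apex   : D4-Vertex

hub : Fin 2 → D4-Vertex
hub c = clique c zero

index : D4-Vertex → Fin 9
index (clique c t) = inject₁ (combine c t)
index apex         = fromℕ 8

vertex : Fin 9 → D4-Vertex
vertex zero                                                = clique zero zero
vertex (suc zero)                                          = clique zero (suc zero)
vertex (suc (suc zero))                                    = clique zero (suc (suc zero))
vertex (suc (suc (suc zero)))                              = clique zero (suc (suc (suc zero)))
vertex (suc (suc (suc (suc zero))))                        = clique (suc zero) zero
vertex (suc (suc (suc (suc (suc zero)))))                  = clique (suc zero) (suc zero)
vertex (suc (suc (suc (suc (suc (suc zero))))))            = clique (suc zero) (suc (suc zero))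
vertex (suc (suc (suc (suc (suc (suc (suc zero)))))))      = clique (suc zero) (suc (suc (suc zero)))
vertex (suc (suc (suc (suc (suc (suc (suc (suc zero)))))))) = apex

index∘vertex : ∀ y → index (vertex y) ≡ y
index∘vertex = toWitness {a? = all? λ y → index (vertex y) ≟ y} tt

vertex∘index : ∀ x → vertex (index x) ≡ x
vertex∘index (clique zero zero)                      = refl
vertex∘index (clique zero (suc zero))                = refl
vertex∘index (clique zero (suc (suc zero)))          = refl
vertex∘index (clique zero (suc (suc (suc zero))))    = refl
vertex∘index (clique (suc zero) zero)                = refl
vertex∘index (clique (suc zero) (suc zero))          = refl
vertex∘index (clique (suc zero) (suc (suc zero)))    = refl
vertex∘index (clique (suc zero) (suc (suc (suc zero)))) = refl
vertex∘index apex                                    = refl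

index-injective : ∀ {x y} → index x ≡ index y → x ≡ y
index-injective {x} {y} eq = trans (sym (vertex∘index x)) (trans (cong vertex eq) (vertex∘index y))

same-or-opposite : ∀ (c c′ : Fin 2) → c′ ≡ c ⊎ c′ ≡ opposite c
same-or-opposite zero       zero       = inj₁ refl
same-or-opposite zero       (suc zero) = inj₂ refl
same-or-opposite (suc zero) zero       = inj₂ refl
same-or-opposite (suc zero) (suc zero) = inj₁ refl

data D4-Edge : D4-Vertex → D4-Vertex → Set where
  clique-edge : ∀ {c s t} → s ≢ t → D4-Edge (clique c s) (clique c t)
  hub-apex    : ∀ c → D4-Edge (hub c) apex
  apex-hub    : ∀ c → D4-Edge apex (hub c)

private
  D4-adj : Fin 9 → Fin 9 → Bool
  D4-adj = adj (D 4)

  adj-clique-clique : ∀ c s c′ t →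
    D4-adj (index (clique c s)) (index (clique c′ t)) ≡ ⌊ c ≟ c′ ⌋ ∧ not ⌊ s ≟ t ⌋
  adj-clique-clique = toWitness {a? = all? λ c → all? λ s → all? λ c′ → all? λ t →
    D4-adj (index (clique c s)) (index (clique c′ t)) ≟ᵇ (⌊ c ≟ c′ ⌋ ∧ not ⌊ s ≟ t ⌋)} tt

  adj-clique-apex : ∀ c s → D4-adj (index (clique c s)) (index apex) ≡ ⌊ s ≟ zero ⌋
  adj-clique-apex = toWitness {a? = all? λ c → all? λ s →
    D4-adj (index (clique c s)) (index apex) ≟ᵇ ⌊ s ≟ zero ⌋} tt

  adj-apex-clique : ∀ c s → D4-adj (index apex) (index (clique c s)) ≡ ⌊ s ≟ zero ⌋
  adj-apex-clique = toWitness {a? = all? λ c → all? λ s →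
    D4-adj (index apex) (index (clique c s)) ≟ᵇ ⌊ s ≟ zero ⌋} tt

Adj⇒D4-Edge : ∀ {x y} → Adj (D 4) (index x) (index y) → D4-Edge x y
Adj⇒D4-Edge {clique c s} {clique c′ t} x~y
  with c≡c′ , s≢t ← to T-∧ (subst T (adj-clique-clique c s c′ t) x~y)
  with refl ← toWitness {a? = c ≟ c′} c≡c′ = clique-edge (toWitnessFalse s≢t)
Adj⇒D4-Edge {clique c s} {apex} x~y
  with refl ← toWitness {a? = s ≟ zero} (subst T (adj-clique-apex c s) x~y) = hub-apex c
Adj⇒D4-Edge {apex} {clique c t} x~y
  with refl ← toWitness {a? = t ≟ zero} (subst T (adj-apex-clique c t) x~y) = apex-hub c

D4-Edge⇒Adj : ∀ {x y} → D4-Edge x y → Adj (D 4) (index x) (index y)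
D4-Edge⇒Adj (clique-edge {c} {s} {t} s≢t) =
  subst T (sym (adj-clique-clique c s c t)) (from T-∧ (fromWitness {a? = c ≟ c} refl , fromWitnessFalse s≢t))
D4-Edge⇒Adj (hub-apex zero)       = tt
D4-Edge⇒Adj (hub-apex (suc zero)) = tt
D4-Edge⇒Adj (apex-hub zero)       = tt
D4-Edge⇒Adj (apex-hub (suc zero)) = tt

D4-Edge-sym : ∀ {x y} → D4-Edge x y → D4-Edge y x
D4-Edge-sym (clique-edge s≢t) = clique-edge (≢-sym s≢t)
D4-Edge-sym (hub-apex c)      = apex-hub c
D4-Edge-sym (apex-hub c)      = hub-apex c

D4-Edge-irrefl : ∀ {x} → ¬ D4-Edge x x
D4-Edge-irrefl (clique-edge s≢s) = s≢s refl

clique-injective : ∀ {c c′ s t} → clique c s ≡ clique c′ t → c ≡ c′ × s ≡ t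
clique-injective refl = refl , refl

opposite-≢ : ∀ (c : Fin 2) → opposite c ≢ c
opposite-≢ zero       ()
opposite-≢ (suc zero) ()

two-others : ∀ (s t : Fin 4) → s ≢ t → ∃₂ λ a b → ∀ u → u ≢ s → u ≢ t → u ≡ a ⊎ u ≡ b
two-others = toWitness {a? = all? λ s → all? λ t → ¬? (s ≟ t) →-dec
  (any? λ a → any? λ b → all? λ u → ¬? (u ≟ s) →-dec (¬? (u ≟ t) →-dec ((u ≟ a) ⊎-dec (u ≟ b))))} tt

one-other : ∀ (s t w : Fin 4) → s ≢ t → s ≢ w → t ≢ w → ∃ λ a → ∀ u → u ≢ s → u ≢ t → u ≢ w → u ≡ a
one-other = toWitness {a? = all? λ s → all? λ t → all? λ w → ¬? (s ≟ t) →-dec (¬? (s ≟ w) →-dec (¬? (t ≟ w) →-dec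
  (any? λ a → all? λ u → ¬? (u ≟ s) →-dec (¬? (u ≟ t) →-dec (¬? (u ≟ w) →-dec (u ≟ a))))))} tt

three-others : ∀ (t : Fin 4) → ∃ λ a → ∃ λ b → ∃ λ d → a ≢ t × b ≢ t × d ≢ t × a ≢ b × a ≢ d × b ≢ d
three-others = toWitness {a? = all? λ t → any? λ a → any? λ b → any? λ d →
  ¬? (a ≟ t) ×-dec ¬? (b ≟ t) ×-dec ¬? (d ≟ t) ×-dec ¬? (a ≟ b) ×-dec ¬? (a ≟ d) ×-dec ¬? (b ≟ d)} tt

-- The product D₄ □ Pₙ

module D₄□P (n : ℕ) where

  Γ : Graph
  Γ = D 4 □ P n

  Vertex : Set
  Vertex = Fin (9 * n)

  private
    variable
      x y : D4-Vertex
      i j : Fin n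
      u v : Vertex

  -- Opaque so that ⟪ x , i ⟫ is a rigid term from which Agda can read off x and i.
  opaque
    ⟪_,_⟫ : D4-Vertex → Fin n → Vertex
    ⟪ x , i ⟫ = combine (index x) i

    ⟪⟫-injective : ⟪ x , i ⟫ ≡ ⟪ y , j ⟫ → x ≡ y × i ≡ j
    ⟪⟫-injective eq = let (x≡y , i≡j) = combine-injective _ _ _ _ eq in index-injective x≡y , i≡j

    ⟪⟫-surjective : ∀ v → ∃ λ ((x , i) : D4-Vertex × Fin n) → ⟪ x , i ⟫ ≡ v
    ⟪⟫-surjective v = let (a , i) = remQuot {9} n v in
      (vertex a , i) , trans (cong (λ b → combine b i) (index∘vertex a)) (combine-remQuot {9} n v)

    adj-⟪⟫ : adj Γ ⟪ x , i ⟫ ⟪ y , j ⟫ ≡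
             (⌊ index x ≟ index y ⌋ ∧ adj (P n) i j) ∨ (⌊ i ≟ j ⌋ ∧ adj (D 4) (index x) (index y))
    adj-⟪⟫ {x} {i} {y} {j} = cong₂ form (remQuot-combine (index x) i) (remQuot-combine (index y) j)
      where
      form : Fin 9 × Fin n → Fin 9 × Fin n → Bool
      form (a , k) (b , l) = (⌊ a ≟ b ⌋ ∧ adj (P n) k l) ∨ (⌊ k ≟ l ⌋ ∧ adj (D 4) a b)

  Adj⇒Edge : Adj Γ ⟪ x , i ⟫ ⟪ y , j ⟫ → (x ≡ y × Consecutive i j) ⊎ (i ≡ j × D4-Edge x y)
  Adj⇒Edge {x} {i} {y} {j} x~y = split (subst T (adj-⟪⟫ {x} {i} {y} {j}) x~y)
    where
    split : T ((⌊ index x ≟ index y ⌋ ∧ adj (P n) i j) ∨ (⌊ i ≟ j ⌋ ∧ adj (D 4) (index x) (index y))) →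
            (x ≡ y × Consecutive i j) ⊎ (i ≡ j × D4-Edge x y)
    split h with to (T-∨ {⌊ index x ≟ index y ⌋ ∧ adj (P n) i j} {⌊ i ≟ j ⌋ ∧ adj (D 4) (index x) (index y)}) h
    ... | inj₁ h₁ = let (x≡y , i~j) = to (T-∧ {⌊ index x ≟ index y ⌋}) h₁ in
      inj₁ (index-injective {x} {y} (toWitness x≡y) , P-Adj⇒Consecutive i~j)
    ... | inj₂ h₂ = let (i≡j , x~y) = to (T-∧ {⌊ i ≟ j ⌋}) h₂ in
      inj₂ (toWitness i≡j , Adj⇒D4-Edge {x} {y} x~y)

  Edge⇒Adj : (x ≡ y × Consecutive i j) ⊎ (i ≡ j × D4-Edge x y) → Adj Γ ⟪ x , i ⟫ ⟪ y , j ⟫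
  Edge⇒Adj {x} {y} {i} {j} e = subst T (sym (adj-⟪⟫ {x} {i} {y} {j}))
    (from (T-∨ {⌊ index x ≟ index y ⌋ ∧ adj (P n) i j} {⌊ i ≟ j ⌋ ∧ adj (D 4) (index x) (index y)}) (split e))
    where
    split : (x ≡ y × Consecutive i j) ⊎ (i ≡ j × D4-Edge x y) →
            T (⌊ index x ≟ index y ⌋ ∧ adj (P n) i j) ⊎ T (⌊ i ≟ j ⌋ ∧ adj (D 4) (index x) (index y))
    split (inj₁ (refl , i~j)) =
      inj₁ (from (T-∧ {⌊ index x ≟ index x ⌋}) (fromWitness {a? = index x ≟ index x} refl , Consecutive⇒P-Adj i~j))
    split (inj₂ (refl , x~y)) =
      inj₂ (from (T-∧ {⌊ i ≟ i ⌋}) (fromWitness {a? = i ≟ i} refl , D4-Edge⇒Adj {x} {y} x~y))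

  ⟪⟫-≢ˣ : x ≢ y → ⟪ x , i ⟫ ≢ ⟪ y , j ⟫
  ⟪⟫-≢ˣ x≢y eq = x≢y (proj₁ (⟪⟫-injective eq))

  ⟪⟫-≢ⁱ : i ≢ j → ⟪ x , i ⟫ ≢ ⟪ y , j ⟫
  ⟪⟫-≢ⁱ i≢j eq = i≢j (proj₂ (⟪⟫-injective eq))

  clique-cells-≢ : ∀ {c s t} → s ≢ t → ⟪ clique c s , i ⟫ ≢ ⟪ clique c t , j ⟫
  clique-cells-≢ s≢t = ⟪⟫-≢ˣ (s≢t ∘ proj₂ ∘ clique-injective)

  data Coordinates : Vertex → Set where
    at : ∀ x i → Coordinates ⟪ x , i ⟫

  coordinates : ∀ v → Coordinates v
  coordinates v = let ((x , i) , ⟪x,i⟫≡v) = ⟪⟫-surjective v in subst Coordinates ⟪x,i⟫≡v (at x i)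

  data Neighbour (x : D4-Vertex) (i : Fin n) : Vertex → Set where
    vertical   : ∀ {j} → Consecutive i j → Neighbour x i ⟪ x , j ⟫
    horizontal : ∀ {y} → D4-Edge x y → Neighbour x i ⟪ y , i ⟫

  neighbour : Adj Γ ⟪ x , i ⟫ v → Neighbour x i v
  neighbour {x} {i} {v} x~v = from-coordinates (coordinates v) x~v
    where
    from-edge : ∀ {y j} → (x ≡ y × Consecutive i j) ⊎ (i ≡ j × D4-Edge x y) → Neighbour x i ⟪ y , j ⟫
    from-edge (inj₁ (refl , i~j)) = vertical i~j
    from-edge (inj₂ (refl , x~y)) = horizontal x~y
    from-coordinates : ∀ {v} → Coordinates v → Adj Γ ⟪ x , i ⟫ v → Neighbour x i v
    from-coordinates (at y j) x~v = from-edge (Adj⇒Edge x~v)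

  Neighbour⇒Adj : Neighbour x i v → Adj Γ ⟪ x , i ⟫ v
  Neighbour⇒Adj (vertical i~j)   = Edge⇒Adj (inj₁ (refl , i~j))
  Neighbour⇒Adj (horizontal x~y) = Edge⇒Adj (inj₂ (refl , x~y))

  Neighbour-≢ : Neighbour x i v → v ≢ ⟪ x , i ⟫
  Neighbour-≢ (vertical i~j)   eq = Consecutive⇒≢ i~j (sym (proj₂ (⟪⟫-injective eq)))
  Neighbour-≢ (horizontal x~y) eq with refl ← proj₁ (⟪⟫-injective eq) = D4-Edge-irrefl x~y

  Neighbour-sym : Neighbour x i v → Adj Γ v ⟪ x , i ⟫
  Neighbour-sym (vertical i~j)   = Neighbour⇒Adj (vertical (Consecutive-sym i~j))
  Neighbour-sym (horizontal x~y) = Neighbour⇒Adj (horizontal (D4-Edge-sym x~y))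

  Adj-sym : Adj Γ u v → Adj Γ v u
  Adj-sym {u} {v} = via-coordinates (coordinates u)
    where
    via-coordinates : ∀ {u} → Coordinates u → Adj Γ u v → Adj Γ v u
    via-coordinates (at x i) u~v = Neighbour-sym (neighbour u~v)

  Adj-irrefl : ¬ Adj Γ u u
  Adj-irrefl {u} = via-coordinates (coordinates u)
    where
    via-coordinates : ∀ {u} → Coordinates u → ¬ Adj Γ u u
    via-coordinates (at x i) u~u = Neighbour-≢ (neighbour u~u) refl

  open GoodNeighbourCuts Γ Adj-sym Adj-irrefl public

-- 3-good-neighbour cuts of D₄ □ Pₙ

module Cut {n : ℕ} (X : Subset (9 * n)) (X-good : GoodNeighborCut (D 4 □ P n) 3 X) where

  open D₄□P n

  private
    variable
      x : D4-Vertex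
      c : Fin 2
      s t : Fin 4
      i j : Fin n
      u v w : Vertex

  _⇝_ : Vertex → Vertex → Set
  u ⇝ v = Reach Γ (∁ X) u v

  ⇝-refl : u ∉ X → u ⇝ u
  ⇝-refl u∉X = here (x∉p⇒x∈∁p u∉X)

  ⇝-step : u ⇝ ⟪ x , i ⟫ → Neighbour x i v → v ∉ X → u ⇝ v
  ⇝-step u⇝w w~v v∉X = step u⇝w (Neighbour⇒Adj w~v) (x∉p⇒x∈∁p v∉X)

  AtLayer : D4-Vertex → (Fin n → Set) → Vertex → Set
  AtLayer x L v = ∃ λ k → L k × v ≡ ⟪ x , k ⟫

  AtLayer-subsingleton : {L : Fin n → Set} → Subsingleton L → Subsingleton (AtLayer x L)
  AtLayer-subsingleton {x} L-sub (k , Lk , refl) (k′ , Lk′ , refl) = cong ⟪ x ,_⟫ (L-sub Lk Lk′)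

  two-escapes⇒⊥ : {E F : Vertex → Set} → ⟪ x , i ⟫ ∉ X → Subsingleton E → Subsingleton F →
                  (∀ {v} → Neighbour x i v → v ∉ X → E v ⊎ F v) → ⊥
  two-escapes⇒⊥ {x} {i} free E-sub F-sub escape =
    <-irrefl refl (≤-trans (proj₂ X-good ⟪ x , i ⟫ (x∉p⇒x∈∁p free))
                           (∣nbhd∩∁X∣≤2 E-sub F-sub λ x~v → escape (neighbour x~v)))

  Clean : D4-Vertex → Set
  Clean x = ∀ i → ⟪ x , i ⟫ ∉ X

  clean? : ∀ x → Dec (Clean x)
  clean? x = all? λ i → ¬? (⟪ x , i ⟫ ∈? X)

  ¬Clean⇒blocked : ¬ Clean x → ∃ λ i → ⟪ x , i ⟫ ∈ X
  ¬Clean⇒blocked {x} unclean =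
    let (i , ¬i∉X) = ¬∀⟶∃¬ n _ (λ i → ¬? (⟪ x , i ⟫ ∈? X)) unclean in i , decidable-stable (⟪ x , i ⟫ ∈? X) ¬i∉X

  ⇝-trans : u ⇝ v → v ⇝ w → u ⇝ w
  ⇝-trans = Reach-trans

  ⇝-sym : u ⇝ v → v ⇝ u
  ⇝-sym = Reach-sym

  clean-column-connected : Clean x → ∀ i j → ⟪ x , i ⟫ ⇝ ⟪ x , j ⟫
  clean-column-connected {x} clean i j =
    let (b , b≡0 , i⇝b) = descend _ i refl
        (b′ , b′≡0 , j⇝b′) = descend _ j refl
    in ⇝-trans i⇝b (subst (λ z → ⟪ x , z ⟫ ⇝ ⟪ x , j ⟫) (toℕ-injective (trans b′≡0 (sym b≡0))) (⇝-sym j⇝b′))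
    where
    descend : ∀ m (i : Fin n) → toℕ i ≡ m → ∃ λ b → toℕ b ≡ 0 × ⟪ x , i ⟫ ⇝ ⟪ x , b ⟫
    descend zero    i i≡0   = i , i≡0 , ⇝-refl (clean i)
    descend (suc m) i i≡1+m =
      let (k , k+1≡i) = predecessor i (subst (0 <_) (sym i≡1+m) (s≤s z≤n))
          (b , b≡0 , k⇝b) = descend m k (suc-injective (trans k+1≡i i≡1+m))
      in b , b≡0 , ⇝-trans (⇝-step (⇝-refl (clean i)) (vertical (inj₂ k+1≡i)) (clean k)) k⇝b

  ⇝-clean-column : Clean (clique c s) → ⟪ clique c t , i ⟫ ∉ X → ∀ j → ⟪ clique c t , i ⟫ ⇝ ⟪ clique c s , j ⟫
  ⇝-clean-column {c} {s} {t} {i} clean free j = via (t ≟ s)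
    where
    via : Dec (t ≡ s) → ⟪ clique c t , i ⟫ ⇝ ⟪ clique c s , j ⟫
    via (yes refl) = clean-column-connected clean i j
    via (no t≢s)   = ⇝-trans (⇝-step (⇝-refl free) (horizontal (clique-edge t≢s)) (clean i))
                             (clean-column-connected clean i j)

  free-hub-is-opposite : ∀ c c′ → ⟪ hub c , j ⟫ ∈ X → ⟪ hub c′ , j ⟫ ∉ X → ⟪ hub c′ , j ⟫ ≡ ⟪ hub (opposite c) , j ⟫
  free-hub-is-opposite zero       zero       hub∈X hub∉X = contradiction hub∈X hub∉X
  free-hub-is-opposite zero       (suc zero) _     _     = refl
  free-hub-is-opposite (suc zero) zero       _     _     = refl
  free-hub-is-opposite (suc zero) (suc zero) hub∈X hub∉X = contradiction hub∈X hub∉X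

  apex-needs-a-free-hub : ⟪ apex , i ⟫ ∉ X → ∃ λ c → ⟪ hub c , i ⟫ ∉ X
  apex-needs-a-free-hub {i} apex∉X = via (⟪ hub zero , i ⟫ ∈? X)
    where
    only-vertical : (∀ c → ⟪ hub c , i ⟫ ∈ X) → ∀ {v} → Neighbour apex i v → v ∉ X →
                    AtLayer apex (i ⋖_) v ⊎ AtLayer apex (_⋖ i) v
    only-vertical _        (vertical (inj₁ i⋖k))    _   = inj₁ (_ , i⋖k , refl)
    only-vertical _        (vertical (inj₂ k⋖i))    _   = inj₂ (_ , k⋖i , refl)
    only-vertical hubs∈X (horizontal (apex-hub c)) v∉X = contradiction (hubs∈X c) v∉X
    via : Dec (⟪ hub zero , i ⟫ ∈ X) → ∃ λ c → ⟪ hub c , i ⟫ ∉ X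
    via (no hub₀∉X)  = zero , hub₀∉X
    via (yes hub₀∈X) = suc zero , λ hub₁∈X →
      two-escapes⇒⊥ apex∉X (AtLayer-subsingleton ⋖-functional) (AtLayer-subsingleton ⋖-injective)
        (only-vertical λ { zero → hub₀∈X ; (suc zero) → hub₁∈X })

  lowest-free-apex : ⟪ apex , i ⟫ ∉ X → ∃ λ j → ⟪ apex , j ⟫ ∉ X × (∀ {k} → k ⋖ j → ⟪ apex , k ⟫ ∈ X)
  lowest-free-apex {i} = descend _ i refl
    where
    descend : ∀ m i → toℕ i ≡ m → ⟪ apex , i ⟫ ∉ X → ∃ λ j → ⟪ apex , j ⟫ ∉ X × (∀ {k} → k ⋖ j → ⟪ apex , k ⟫ ∈ X)
    descend zero    i i≡0   apex∉X = i , apex∉X , λ k⋖i → contradiction (trans k⋖i i≡0) 1+n≢0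
    descend (suc m) i i≡1+m apex∉X = via (⟪ apex , i⁻ ⟫ ∈? X)
      where
      i⁻ : Fin n
      i⁻ = proj₁ (predecessor i (subst (0 <_) (sym i≡1+m) (s≤s z≤n)))
      i⁻⋖i : i⁻ ⋖ i
      i⁻⋖i = proj₂ (predecessor i (subst (0 <_) (sym i≡1+m) (s≤s z≤n)))
      via : Dec (⟪ apex , i⁻ ⟫ ∈ X) → ∃ λ j → ⟪ apex , j ⟫ ∉ X × (∀ {k} → k ⋖ j → ⟪ apex , k ⟫ ∈ X)
      via (yes i⁻∈X) = i , apex∉X , λ k⋖i → subst (λ k → ⟪ apex , k ⟫ ∈ X) (⋖-injective i⁻⋖i k⋖i) i⁻∈X
      via (no i⁻∉X)  = descend m i⁻ (suc-injective (trans i⁻⋖i i≡1+m)) i⁻∉X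

  lowest-free-apex-has-free-hubs : ⟪ apex , j ⟫ ∉ X → (∀ {k} → k ⋖ j → ⟪ apex , k ⟫ ∈ X) → ∀ c → ⟪ hub c , j ⟫ ∉ X
  lowest-free-apex-has-free-hubs {j} apex∉X below∈X c hub∈X =
    two-escapes⇒⊥ apex∉X (AtLayer-subsingleton ⋖-functional) ≡-subsingleton escape
    where
    escape : ∀ {v} → Neighbour apex j v → v ∉ X → AtLayer apex (j ⋖_) v ⊎ v ≡ ⟪ hub (opposite c) , j ⟫
    escape (vertical (inj₁ j⋖k))     _   = inj₁ (_ , j⋖k , refl)
    escape (vertical (inj₂ k⋖j))     v∉X = contradiction (below∈X k⋖j) v∉X
    escape (horizontal (apex-hub c′)) v∉X = inj₂ (free-hub-is-opposite c c′ hub∈X v∉X)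

  apex-with-free-hubs : ⟪ apex , i ⟫ ∉ X → ∃ λ j → ⟪ apex , j ⟫ ∉ X × ∀ c → ⟪ hub c , j ⟫ ∉ X
  apex-with-free-hubs apex∉X = let (j , apex-j∉X , below∈X) = lowest-free-apex apex∉X in
    j , apex-j∉X , lowest-free-apex-has-free-hubs apex-j∉X below∈X

  module BothCliquesClean (clean : ∀ c → ∃ λ t → Clean (clique c t)) {i₀ : Fin n} (apex∉X : ⟪ apex , i₀ ⟫ ∉ X) where

    root : Fin 2 → Vertex
    root c = ⟪ clique c (proj₁ (clean c)) , i₀ ⟫

    ⇝-root : ⟪ clique c t , i ⟫ ∉ X → ⟪ clique c t , i ⟫ ⇝ root c
    ⇝-root {c} free = ⇝-clean-column (proj₂ (clean c)) free i₀

    ⇝-some-root : u ∉ X → ∃ λ c → u ⇝ root c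
    ⇝-some-root {u} = via (coordinates u)
      where
      via : ∀ {u} → Coordinates u → u ∉ X → ∃ λ c → u ⇝ root c
      via (at (clique c t) i) free = c , ⇝-root free
      via (at apex i)         free = let (c , hub∉X) = apex-needs-a-free-hub free in
        c , ⇝-trans (⇝-step (⇝-refl free) (horizontal (apex-hub c)) hub∉X) (⇝-root hub∉X)

    roots-connected : ∀ c c′ → root c ⇝ root c′
    roots-connected c c′ = let (j , apex-j∉X , hub∉X) = apex-with-free-hubs apex∉X in
      ⇝-trans (⇝-sym (⇝-root (hub∉X c)))
        (⇝-trans (⇝-step (⇝-step (⇝-refl (hub∉X c)) (horizontal (hub-apex c)) apex-j∉X)
                          (horizontal (apex-hub c′)) (hub∉X c′))
                 (⇝-root (hub∉X c′)))

    connected : u ∉ X → v ∉ X → u ⇝ v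
    connected u∉X v∉X =
      let (c , u⇝c) = ⇝-some-root u∉X ; (c′ , v⇝c′) = ⇝-some-root v∉X in
      ⇝-trans u⇝c (⇝-trans (roots-connected c c′) (⇝-sym v⇝c′))

-- Cuts of at most five vertices contain the apex column

module SmallCut {n : ℕ} (X : Subset (9 * n)) (X-good : GoodNeighborCut (D 4 □ P n) 3 X)
                (3≤n : 3 ≤ n) (∣X∣≤5 : ∣ X ∣ ≤ 5) where

  open D₄□P n
  open Cut {n} X X-good

  private
    variable
      x y y′ : D4-Vertex
      c : Fin 2
      s t : Fin 4
      i j j′ l : Fin n
      u v : Vertex

    2≤n : 2 ≤ n
    2≤n = ≤-trans (s≤s (s≤s z≤n)) 3≤n

  over-budget : ∀ {a b c d e f} → Unique (a ∷ b ∷ c ∷ d ∷ e ∷ f ∷ []) → All (_∈ X) (a ∷ b ∷ c ∷ d ∷ e ∷ f ∷ []) → ⊥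
  over-budget distinct in-X = <-irrefl refl (≤-trans (length≤∣p∣ distinct in-X) ∣X∣≤5)

  -- Four vertices of X lie in the four columns of clique c, so X has at most one vertex elsewhere; then the
  -- other clique has a column avoiding X and everything outside clique c reaches ρ. A vertex of clique c that
  -- cannot reach ρ is stuck; stuck vertices occupy at most two layers, and each configuration is ruled out
  -- by counting vertices of X or by exhibiting an apex vertex with at most two neighbours outside X.
  module BlockedClique (c : Fin 2) (blocked : ∀ t → ∃ λ i → ⟪ clique c t , i ⟫ ∈ X) where

    c′ : Fin 2
    c′ = opposite c

    blocker : Fin 4 → Vertex
    blocker t = ⟪ clique c t , proj₁ (blocked t) ⟫

    blocker∈X : ∀ t → blocker t ∈ X
    blocker∈X t = proj₂ (blocked t)

    blocker-≢ : s ≢ t → blocker s ≢ blocker t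
    blocker-≢ = clique-cells-≢

    OffClique : D4-Vertex → Set
    OffClique y = ∀ t → y ≢ clique c t

    apex-off-clique : OffClique apex
    apex-off-clique t ()

    opposite-off-clique : OffClique (clique c′ s)
    opposite-off-clique t eq = opposite-≢ c (proj₁ (clique-injective eq))

    off-clique-unique : OffClique y → OffClique y′ → ⟪ y , j ⟫ ∈ X → ⟪ y′ , j′ ⟫ ∈ X → y ≡ y′ × j ≡ j′
    off-clique-unique {y} {y′} {j} {j′} y-off y′-off y∈X y′∈X = via (⟪ y , j ⟫ ≟ ⟪ y′ , j′ ⟫)
      where
      via : Dec (⟪ y , j ⟫ ≡ ⟪ y′ , j′ ⟫) → y ≡ y′ × j ≡ j′
      via (yes eq) = ⟪⟫-injective eq
      via (no y≢y′) = ⊥-elim (over-budget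
        ( (y≢y′ ∷ y≢blocker (# 0) ∷ y≢blocker (# 1) ∷ y≢blocker (# 2) ∷ y≢blocker (# 3) ∷ [])
        ∷ (y′≢blocker (# 0) ∷ y′≢blocker (# 1) ∷ y′≢blocker (# 2) ∷ y′≢blocker (# 3) ∷ [])
        ∷ (blocker-≢ (λ ()) ∷ blocker-≢ (λ ()) ∷ blocker-≢ (λ ()) ∷ [])
        ∷ (blocker-≢ (λ ()) ∷ blocker-≢ (λ ()) ∷ [])
        ∷ (blocker-≢ (λ ()) ∷ [])
        ∷ [] ∷ [])
        (y∈X ∷ y′∈X ∷ blocker∈X (# 0) ∷ blocker∈X (# 1) ∷ blocker∈X (# 2) ∷ blocker∈X (# 3) ∷ []))
        where
        y≢blocker : ∀ t → ⟪ y , j ⟫ ≢ blocker t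
        y≢blocker t = ⟪⟫-≢ˣ (y-off t)
        y′≢blocker : ∀ t → ⟪ y′ , j′ ⟫ ≢ blocker t
        y′≢blocker t = ⟪⟫-≢ˣ (y′-off t)

    opposite-clean-column : ∃ λ b → Clean (clique c′ b)
    opposite-clean-column = via (clean? (clique c′ (# 1))) (clean? (clique c′ (# 2)))
      where
      via : Dec (Clean (clique c′ (# 1))) → Dec (Clean (clique c′ (# 2))) → ∃ λ b → Clean (clique c′ b)
      via (yes clean) _           = # 1 , clean
      via (no _)      (yes clean) = # 2 , clean
      via (no dirty₁) (no dirty₂) =
        let (_ , ∈X₁) = ¬Clean⇒blocked dirty₁
            (_ , ∈X₂) = ¬Clean⇒blocked dirty₂
            same-vertex = off-clique-unique opposite-off-clique opposite-off-clique ∈X₁ ∈X₂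
        in contradiction (proj₂ (clique-injective (proj₁ same-vertex))) λ ()

    -- Any layer would do.
    ρ : Vertex
    ρ = ⟪ clique c′ (proj₁ opposite-clean-column) , proj₁ (blocked zero) ⟫

    opposite⇝ρ : ⟪ clique c′ t , i ⟫ ∉ X → ⟪ clique c′ t , i ⟫ ⇝ ρ
    opposite⇝ρ free = ⇝-clean-column (proj₂ opposite-clean-column) free _

    apex⇝ρ : ⟪ apex , j ⟫ ∉ X → ⟪ apex , j ⟫ ⇝ ρ
    apex⇝ρ {j} apex∉X = via (⟪ hub c′ , j ⟫ ∈? X)
      where
      via : Dec (⟪ hub c′ , j ⟫ ∈ X) → ⟪ apex , j ⟫ ⇝ ρ
      via (no hub∉X)  = ⇝-trans (⇝-step (⇝-refl apex∉X) (horizontal (apex-hub c′)) hub∉X) (opposite⇝ρ hub∉X)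
      via (yes hub∈X) =
        ⇝-trans (⇝-step (⇝-step (⇝-refl apex∉X) (vertical j~j⁺) apex-j⁺∉X) (horizontal (apex-hub c′)) hub-j⁺∉X)
                (opposite⇝ρ hub-j⁺∉X)
        where
        j⁺ : Fin n
        j⁺ = proj₁ (∃-consecutive 2≤n j)
        j~j⁺ : Consecutive j j⁺
        j~j⁺ = proj₂ (∃-consecutive 2≤n j)
        apex-j⁺∉X : ⟪ apex , j⁺ ⟫ ∉ X
        apex-j⁺∉X apex∈X =
          contradiction (proj₁ (off-clique-unique apex-off-clique opposite-off-clique apex∈X hub∈X)) λ ()
        hub-j⁺∉X : ⟪ hub c′ , j⁺ ⟫ ∉ X
        hub-j⁺∉X hub-j⁺∈X =
          Consecutive⇒≢ j~j⁺ (sym (proj₂ (off-clique-unique opposite-off-clique opposite-off-clique hub-j⁺∈X hub∈X)))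

    Stuck : Vertex → Set
    Stuck w = w ∉ X × ¬ (w ⇝ ρ)

    Stuck-step : Stuck ⟪ x , i ⟫ → Neighbour x i v → v ∉ X → Stuck v
    Stuck-step (free , ¬⇝ρ) x~v v∉X = v∉X , λ v⇝ρ → ¬⇝ρ (⇝-trans (⇝-step (⇝-refl free) x~v v∉X) v⇝ρ)

    stuck-hub⇒apex∈X : Stuck ⟪ hub c , j ⟫ → ⟪ apex , j ⟫ ∈ X
    stuck-hub⇒apex∈X {j} stuck = decidable-stable (⟪ apex , j ⟫ ∈? X) λ apex∉X →
      proj₂ (Stuck-step stuck (horizontal (hub-apex c)) apex∉X) (apex⇝ρ apex∉X)

    StuckLayer : Fin n → Set
    StuckLayer l = ∃ λ t → Stuck ⟪ clique c t , l ⟫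

    stuck-blocks-vertical : ∀ {k} → Stuck ⟪ clique c t , l ⟫ → Consecutive l k → ¬ StuckLayer k →
                            ⟪ clique c t , k ⟫ ∈ X
    stuck-blocks-vertical {t} {l} {k} stuck l~k k-free = decidable-stable (⟪ clique c t , k ⟫ ∈? X) λ ∉X →
      k-free (t , Stuck-step stuck (vertical l~k) ∉X)

    stuck-layer-cell : StuckLayer l → ∀ t → ⟪ clique c t , l ⟫ ∈ X ⊎ Stuck ⟪ clique c t , l ⟫
    stuck-layer-cell {l} (s , stuck) t = via (t ≟ s) (⟪ clique c t , l ⟫ ∈? X)
      where
      via : Dec (t ≡ s) → Dec (⟪ clique c t , l ⟫ ∈ X) → ⟪ clique c t , l ⟫ ∈ X ⊎ Stuck ⟪ clique c t , l ⟫
      via (yes refl) _         = inj₂ stuck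
      via (no _)     (yes ∈X)  = inj₁ ∈X
      via (no t≢s)   (no ∉X)   = inj₂ (Stuck-step stuck (horizontal (clique-edge (≢-sym t≢s))) ∉X)

    HubOrApex : D4-Vertex → Set
    HubOrApex y = y ≡ hub c ⊎ y ≡ apex

    ≢non-hub-cell : HubOrApex y → t ≢ zero → ⟪ y , j ⟫ ≢ ⟪ clique c t , l ⟫
    ≢non-hub-cell (inj₁ refl) t≢0 = clique-cells-≢ (≢-sym t≢0)
    ≢non-hub-cell (inj₂ refl) _   = ⟪⟫-≢ˣ λ ()

    stuck-layer-hub-or-apex∈X : StuckLayer l → ∃ λ y → HubOrApex y × ⟪ y , l ⟫ ∈ X
    stuck-layer-hub-or-apex∈X L = [ (λ hub∈X → hub c , inj₁ refl , hub∈X)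
                                  , (λ stuck → apex , inj₂ refl , stuck-hub⇒apex∈X stuck) ] (stuck-layer-cell L zero)

    at-most-two-stuck-layers : ∀ {j₁ j₂ j₃} → StuckLayer j₁ → StuckLayer j₂ → StuckLayer j₃ →
                               j₁ ≢ j₂ → j₁ ≢ j₃ → j₂ ≢ j₃ → ⊥
    at-most-two-stuck-layers L₁ L₂ L₃ j₁≢j₂ j₁≢j₃ j₂≢j₃ =
      let (_ , m₁ , ∈X₁) = stuck-layer-hub-or-apex∈X L₁
          (_ , m₂ , ∈X₂) = stuck-layer-hub-or-apex∈X L₂
          (_ , m₃ , ∈X₃) = stuck-layer-hub-or-apex∈X L₃
      in over-budget
        ( (⟪⟫-≢ⁱ j₁≢j₂ ∷ ⟪⟫-≢ⁱ j₁≢j₃ ∷ ≢non-hub-cell m₁ (λ ()) ∷ ≢non-hub-cell m₁ (λ ()) ∷ ≢non-hub-cell m₁ (λ ()) ∷ [])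
        ∷ (⟪⟫-≢ⁱ j₂≢j₃ ∷ ≢non-hub-cell m₂ (λ ()) ∷ ≢non-hub-cell m₂ (λ ()) ∷ ≢non-hub-cell m₂ (λ ()) ∷ [])
        ∷ (≢non-hub-cell m₃ (λ ()) ∷ ≢non-hub-cell m₃ (λ ()) ∷ ≢non-hub-cell m₃ (λ ()) ∷ [])
        ∷ (blocker-≢ (λ ()) ∷ blocker-≢ (λ ()) ∷ [])
        ∷ (blocker-≢ (λ ()) ∷ [])
        ∷ [] ∷ [])
        (∈X₁ ∷ ∈X₂ ∷ ∈X₃ ∷ blocker∈X (# 1) ∷ blocker∈X (# 2) ∷ blocker∈X (# 3) ∷ [])

    Isolated : Fin n → Set
    Isolated l = ∀ {k} → Consecutive l k → ¬ StuckLayer k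

    isolated-layer-full : Stuck ⟪ clique c s , l ⟫ → Isolated l → ∀ t → Stuck ⟪ clique c t , l ⟫
    isolated-layer-full {s} {l} stuck isolated t =
      [ (λ t∈X → ⊥-elim (blocked-cell⇒⊥ t∈X)) , id ] (stuck-layer-cell (s , stuck) t)
      where
      blocked-cell⇒⊥ : ⟪ clique c t , l ⟫ ∈ X → ⊥
      blocked-cell⇒⊥ t∈X = via (two-others s t (≢-sym t≢s))
        where
        t≢s : t ≢ s
        t≢s refl = proj₁ stuck t∈X
        via : (∃₂ λ a b → ∀ u → u ≢ s → u ≢ t → u ≡ a ⊎ u ≡ b) → ⊥
        via (a , b , others) = two-escapes⇒⊥ (proj₁ stuck) ≡-subsingleton ≡-subsingleton escape
          where
          escape : ∀ {v} → Neighbour (clique c s) l v → v ∉ X → v ≡ ⟪ clique c a , l ⟫ ⊎ v ≡ ⟪ clique c b , l ⟫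
          escape (vertical l~k) v∉X = contradiction (stuck-blocks-vertical stuck l~k (isolated l~k)) v∉X
          escape (horizontal (clique-edge {t = u} s≢u)) v∉X =
            map (cong λ z → ⟪ clique c z , l ⟫) (cong λ z → ⟪ clique c z , l ⟫)
              (others u (≢-sym s≢u) λ { refl → v∉X t∈X })
          escape (horizontal (hub-apex _)) v∉X = contradiction (stuck-hub⇒apex∈X stuck) v∉X

    isolated-layer-surrounded : ∀ {k} → Stuck ⟪ clique c s , l ⟫ → Isolated l → Consecutive l k →
                                ∀ t → ⟪ clique c t , k ⟫ ∈ X
    isolated-layer-surrounded stuck isolated l~k t =
      stuck-blocks-vertical (isolated-layer-full stuck isolated t) l~k (isolated l~k)

    isolated-layer-apex∈X : Stuck ⟪ clique c s , l ⟫ → Isolated l → ⟪ apex , l ⟫ ∈ X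
    isolated-layer-apex∈X stuck isolated = stuck-hub⇒apex∈X (isolated-layer-full stuck isolated zero)

    single-stuck-layer⇒⊥ : Stuck ⟪ clique c s , l ⟫ → (∀ {j} → StuckLayer j → j ≡ l) → ⊥
    single-stuck-layer⇒⊥ {s} {l} stuck only =
      two-escapes⇒⊥ apex-k∉X ≡-subsingleton (AtLayer-subsingleton (other-neighbour-unique k~l)) escape
      where
      isolated : Isolated l
      isolated l~k L = Consecutive⇒≢ l~k (sym (only L))
      k : Fin n
      k = proj₁ (∃-consecutive 2≤n l)
      l~k : Consecutive l k
      l~k = proj₂ (∃-consecutive 2≤n l)
      k~l : Consecutive k l
      k~l = Consecutive-sym l~k
      surrounded : ∀ t → ⟪ clique c t , k ⟫ ∈ X
      surrounded = isolated-layer-surrounded stuck isolated l~k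
      apex-l∈X : ⟪ apex , l ⟫ ∈ X
      apex-l∈X = isolated-layer-apex∈X stuck isolated
      apex-k∉X : ⟪ apex , k ⟫ ∉ X
      apex-k∉X apex-k∈X = over-budget
        ( (clique-cells-≢ (λ ()) ∷ clique-cells-≢ (λ ()) ∷ clique-cells-≢ (λ ()) ∷ ⟪⟫-≢ˣ (λ ()) ∷ ⟪⟫-≢ˣ (λ ()) ∷ [])
        ∷ (clique-cells-≢ (λ ()) ∷ clique-cells-≢ (λ ()) ∷ ⟪⟫-≢ˣ (λ ()) ∷ ⟪⟫-≢ˣ (λ ()) ∷ [])
        ∷ (clique-cells-≢ (λ ()) ∷ ⟪⟫-≢ˣ (λ ()) ∷ ⟪⟫-≢ˣ (λ ()) ∷ [])
        ∷ (⟪⟫-≢ˣ (λ ()) ∷ ⟪⟫-≢ˣ (λ ()) ∷ [])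
        ∷ (⟪⟫-≢ⁱ (Consecutive⇒≢ l~k) ∷ [])
        ∷ [] ∷ [])
        (surrounded (# 0) ∷ surrounded (# 1) ∷ surrounded (# 2) ∷ surrounded (# 3) ∷ apex-l∈X ∷ apex-k∈X ∷ [])
      escape : ∀ {v} → Neighbour apex k v → v ∉ X → v ≡ ⟪ hub c′ , k ⟫ ⊎ AtLayer apex (λ m → Consecutive k m × m ≢ l) v
      escape (vertical k~m)             v∉X = inj₂ (_ , (k~m , λ { refl → v∉X apex-l∈X }) , refl)
      escape (horizontal (apex-hub c″)) v∉X = inj₁ (free-hub-is-opposite c c″ (surrounded zero) v∉X)

    -- With p, q the only stuck layers and r the other neighbour of q: the hub of q is in X, columns 1–3 of layers
    -- q and p are stuck, those columns meet X only in layer r, so q is the only neighbour of p, and then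
    -- the apex of p or of q has at most two neighbours outside X.
    module AdjacentStuckLayers {p q r : Fin n} (Lp : StuckLayer p) (Lq : StuckLayer q)
        (only : ∀ {l} → StuckLayer l → l ≡ p ⊎ l ≡ q)
        (p~q : Consecutive p q) (q~r : Consecutive q r) (r≢p : r ≢ p) where

      p≢q : p ≢ q
      p≢q = Consecutive⇒≢ p~q

      q≢r : q ≢ r
      q≢r = Consecutive⇒≢ q~r

      p≢r : p ≢ r
      p≢r = ≢-sym r≢p

      r-not-stuck : ¬ StuckLayer r
      r-not-stuck L = [ r≢p , (λ r≡q → q≢r (sym r≡q)) ] (only L)

      below-stuck-q∈X : Stuck ⟪ clique c t , q ⟫ → ⟪ clique c t , r ⟫ ∈ X
      below-stuck-q∈X stuck = stuck-blocks-vertical stuck q~r r-not-stuck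

      yp : D4-Vertex
      yp = proj₁ (stuck-layer-hub-or-apex∈X Lp)
      yp-kind : HubOrApex yp
      yp-kind = proj₁ (proj₂ (stuck-layer-hub-or-apex∈X Lp))
      yp∈X : ⟪ yp , p ⟫ ∈ X
      yp∈X = proj₂ (proj₂ (stuck-layer-hub-or-apex∈X Lp))

      yq : D4-Vertex
      yq = proj₁ (stuck-layer-hub-or-apex∈X Lq)
      yq-kind : HubOrApex yq
      yq-kind = proj₁ (proj₂ (stuck-layer-hub-or-apex∈X Lq))
      yq∈X : ⟪ yq , q ⟫ ∈ X
      yq∈X = proj₂ (proj₂ (stuck-layer-hub-or-apex∈X Lq))

      hub-q-not-stuck : ¬ Stuck ⟪ hub c , q ⟫
      hub-q-not-stuck stuck = over-budget
        ( (⟪⟫-≢ⁱ p≢q ∷ ≢non-hub-cell yp-kind (λ ()) ∷ ≢non-hub-cell yp-kind (λ ())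
           ∷ ≢non-hub-cell yp-kind (λ ()) ∷ ⟪⟫-≢ⁱ p≢r ∷ [])
        ∷ (≢non-hub-cell yq-kind (λ ()) ∷ ≢non-hub-cell yq-kind (λ ()) ∷ ≢non-hub-cell yq-kind (λ ())
           ∷ ⟪⟫-≢ⁱ q≢r ∷ [])
        ∷ (blocker-≢ (λ ()) ∷ blocker-≢ (λ ()) ∷ clique-cells-≢ (λ ()) ∷ [])
        ∷ (blocker-≢ (λ ()) ∷ clique-cells-≢ (λ ()) ∷ [])
        ∷ (clique-cells-≢ (λ ()) ∷ [])
        ∷ [] ∷ [])
        (yp∈X ∷ yq∈X ∷ blocker∈X (# 1) ∷ blocker∈X (# 2) ∷ blocker∈X (# 3) ∷ below-stuck-q∈X stuck ∷ [])

      hub-q∈X : ⟪ hub c , q ⟫ ∈ X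
      hub-q∈X = [ id , (λ stuck → ⊥-elim (hub-q-not-stuck stuck)) ] (stuck-layer-cell Lq zero)

      q-row-gap⇒⊥ : ∀ {s t} → Stuck ⟪ clique c s , q ⟫ → t ≢ zero → ⟪ clique c t , q ⟫ ∈ X → ⊥
      q-row-gap⇒⊥ {s} {t} stuck t≢0 t∈X = via (one-other s zero t s≢0 (≢-sym t≢s) (≢-sym t≢0))
        where
        s≢0 : s ≢ zero
        s≢0 refl = hub-q-not-stuck stuck
        t≢s : t ≢ s
        t≢s refl = proj₁ stuck t∈X
        via : (∃ λ a → ∀ u → u ≢ s → u ≢ zero → u ≢ t → u ≡ a) → ⊥
        via (a , other) = two-escapes⇒⊥ (proj₁ stuck) ≡-subsingleton ≡-subsingleton escape
          where
          escape : ∀ {v} → Neighbour (clique c s) q v → v ∉ X → v ≡ ⟪ clique c a , q ⟫ ⊎ v ≡ ⟪ clique c s , p ⟫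
          escape (vertical {k} q~k) v∉X = inj₂ (cong ⟪ clique c s ,_⟫
            (other-neighbour-unique q~r (q~k , λ { refl → v∉X (below-stuck-q∈X stuck) }) (Consecutive-sym p~q , p≢r)))
          escape (horizontal (clique-edge {t = u} s≢u)) v∉X = inj₁ (cong (λ z → ⟪ clique c z , q ⟫)
            (other u (≢-sym s≢u) (λ { refl → v∉X hub-q∈X }) (λ { refl → v∉X t∈X })))
          escape (horizontal (hub-apex _)) _ = ⊥-elim (s≢0 refl)

      q-row-stuck : ∀ t → t ≢ zero → Stuck ⟪ clique c t , q ⟫
      q-row-stuck t t≢0 = [ (λ t∈X → ⊥-elim (q-row-gap⇒⊥ (proj₂ Lq) t≢0 t∈X)) , id ] (stuck-layer-cell Lq t)

      column-blocked-only-at-r : t ≢ zero → ⟪ clique c t , l ⟫ ∈ X → l ≡ r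
      column-blocked-only-at-r {t} {l} t≢0 t∈X = decidable-stable (l ≟ r) λ l≢r → over-budget
        ( (⟪⟫-≢ⁱ p≢q ∷ ⟪⟫-≢ⁱ p≢r ∷ ⟪⟫-≢ⁱ p≢r ∷ ⟪⟫-≢ⁱ p≢r ∷ ≢non-hub-cell yp-kind t≢0 ∷ [])
        ∷ (⟪⟫-≢ⁱ q≢r ∷ ⟪⟫-≢ⁱ q≢r ∷ ⟪⟫-≢ⁱ q≢r ∷ ≢non-hub-cell yq-kind t≢0 ∷ [])
        ∷ (clique-cells-≢ (λ ()) ∷ clique-cells-≢ (λ ()) ∷ ⟪⟫-≢ⁱ (≢-sym l≢r) ∷ [])
        ∷ (clique-cells-≢ (λ ()) ∷ ⟪⟫-≢ⁱ (≢-sym l≢r) ∷ [])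
        ∷ (⟪⟫-≢ⁱ (≢-sym l≢r) ∷ [])
        ∷ [] ∷ [])
        (yp∈X ∷ yq∈X ∷ r-cell∈X (# 1) (λ ()) ∷ r-cell∈X (# 2) (λ ()) ∷ r-cell∈X (# 3) (λ ()) ∷ t∈X ∷ [])
        where
        r-cell∈X : ∀ u → u ≢ zero → ⟪ clique c u , r ⟫ ∈ X
        r-cell∈X u u≢0 = below-stuck-q∈X (q-row-stuck u u≢0)

      p-row-stuck : ∀ t → t ≢ zero → Stuck ⟪ clique c t , p ⟫
      p-row-stuck t t≢0 = Stuck-step (q-row-stuck t t≢0) (vertical (Consecutive-sym p~q))
                                     (λ ∈X → p≢r (column-blocked-only-at-r t≢0 ∈X))

      p-neighbour-is-q : ∀ {k} → Consecutive p k → k ≡ q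
      p-neighbour-is-q {k} p~k = decidable-stable (k ≟ q) λ k≢q →
        [ (λ k≡p → Consecutive⇒≢ p~k (sym k≡p)) , k≢q ]
          (only (# 1 , Stuck-step (p-row-stuck (# 1) (λ ())) (vertical p~k)
                                  (λ ∈X → k≢r (column-blocked-only-at-r (λ ()) ∈X))))
        where
        k≢r : k ≢ r
        k≢r refl = no-triangle p~q q~r p~k

      absurd : ⊥
      absurd = via (⟪ apex , p ⟫ ∈? X)
        where
        via : Dec (⟪ apex , p ⟫ ∈ X) → ⊥
        via (yes apex-p∈X) =
          two-escapes⇒⊥ apex-q∉X ≡-subsingleton (AtLayer-subsingleton (other-neighbour-unique (Consecutive-sym p~q)))
                        escape
          where
          apex-q∉X : ⟪ apex , q ⟫ ∉ X
          apex-q∉X apex-q∈X = p≢q (proj₂ (off-clique-unique apex-off-clique apex-off-clique apex-p∈X apex-q∈X))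
          escape : ∀ {v} → Neighbour apex q v → v ∉ X →
                   v ≡ ⟪ hub c′ , q ⟫ ⊎ AtLayer apex (λ k → Consecutive q k × k ≢ p) v
          escape (vertical q~k)             v∉X = inj₂ (_ , (q~k , λ { refl → v∉X apex-p∈X }) , refl)
          escape (horizontal (apex-hub c″)) v∉X = inj₁ (free-hub-is-opposite c c″ hub-q∈X v∉X)
        via (no apex-p∉X) = two-escapes⇒⊥ apex-p∉X ≡-subsingleton ≡-subsingleton escape
          where
          hub-p∈X : ⟪ hub c , p ⟫ ∈ X
          hub-p∈X = [ (λ yp≡hub → subst (λ y → ⟪ y , p ⟫ ∈ X) yp≡hub yp∈X)
                    , (λ yp≡apex → contradiction (subst (λ y → ⟪ y , p ⟫ ∈ X) yp≡apex yp∈X) apex-p∉X) ] yp-kind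
          escape : ∀ {v} → Neighbour apex p v → v ∉ X → v ≡ ⟪ hub c′ , p ⟫ ⊎ v ≡ ⟪ apex , q ⟫
          escape (vertical p~k)             _   = inj₂ (cong ⟪ apex ,_⟫ (p-neighbour-is-q p~k))
          escape (horizontal (apex-hub c″)) v∉X = inj₁ (free-hub-is-opposite c c″ hub-p∈X v∉X)

    two-stuck-layers⇒⊥ : ∀ {s t i j} → Stuck ⟪ clique c s , i ⟫ → Stuck ⟪ clique c t , j ⟫ → j ≢ i → ⊥
    two-stuck-layers⇒⊥ {s} {t} {i} {j} stuck-i stuck-j j≢i = via (consecutive? i j)
      where
      Li : StuckLayer i
      Li = s , stuck-i
      Lj : StuckLayer j
      Lj = t , stuck-j
      only : ∀ {l} → StuckLayer l → l ≡ i ⊎ l ≡ j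
      only {l} L = via′ (l ≟ i) (l ≟ j)
        where
        via′ : Dec (l ≡ i) → Dec (l ≡ j) → l ≡ i ⊎ l ≡ j
        via′ (yes l≡i) _         = inj₁ l≡i
        via′ (no _)    (yes l≡j) = inj₂ l≡j
        via′ (no l≢i)  (no l≢j)  = ⊥-elim (at-most-two-stuck-layers Li Lj L (≢-sym j≢i) (≢-sym l≢i) (≢-sym l≢j))
      via : Dec (Consecutive i j) → ⊥
      via (no i≁j) = j≢i (proj₂ (off-clique-unique apex-off-clique apex-off-clique apex-j∈X apex-i∈X))
        where
        isolated-i : Isolated i
        isolated-i i~k L = [ (λ { refl → Consecutive⇒≢ i~k refl }) , (λ { refl → i≁j i~k }) ] (only L)
        isolated-j : Isolated j
        isolated-j j~k L = [ (λ { refl → i≁j (Consecutive-sym j~k) }) , (λ { refl → Consecutive⇒≢ j~k refl }) ] (only L)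
        apex-i∈X : ⟪ apex , i ⟫ ∈ X
        apex-i∈X = isolated-layer-apex∈X stuck-i isolated-i
        apex-j∈X : ⟪ apex , j ⟫ ∈ X
        apex-j∈X = isolated-layer-apex∈X stuck-j isolated-j
      via (yes i~j) = extend (∃-extension 3≤n i~j)
        where
        extend : (∃ λ r → (Consecutive j r × r ≢ i) ⊎ (Consecutive i r × r ≢ j)) → ⊥
        extend (r , inj₁ (j~r , r≢i)) = AdjacentStuckLayers.absurd Li Lj only i~j j~r r≢i
        extend (r , inj₂ (i~r , r≢j)) = AdjacentStuckLayers.absurd Lj Li (swap ∘ only) (Consecutive-sym i~j) i~r r≢j

    clique⇝ρ : ⟪ clique c s , i ⟫ ∉ X → ¬ ¬ (⟪ clique c s , i ⟫ ⇝ ρ)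
    clique⇝ρ {s} {i} free ¬⇝ρ = single-stuck-layer⇒⊥ (free , ¬⇝ρ) only
      where
      only : ∀ {j} → StuckLayer j → j ≡ i
      only {j} (t , stuck) = decidable-stable (j ≟ i) (two-stuck-layers⇒⊥ (free , ¬⇝ρ) stuck)

    ⇝ρ : u ∉ X → ¬ ¬ (u ⇝ ρ)
    ⇝ρ {u} = via (coordinates u)
      where
      via : ∀ {u} → Coordinates u → u ∉ X → ¬ ¬ (u ⇝ ρ)
      via (at (clique c″ t) i) free = by-clique (same-or-opposite c c″)
        where
        by-clique : c″ ≡ c ⊎ c″ ≡ c′ → ¬ ¬ (⟪ clique c″ t , i ⟫ ⇝ ρ)
        by-clique (inj₁ refl) = clique⇝ρ free
        by-clique (inj₂ refl) ¬⇝ρ = ¬⇝ρ (opposite⇝ρ free)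
      via (at apex i) free ¬⇝ρ = ¬⇝ρ (apex⇝ρ free)

    connected : u ∉ X → v ∉ X → ¬ ¬ (u ⇝ v)
    connected u∉X v∉X ¬u⇝v = ⇝ρ u∉X λ u⇝ρ → ⇝ρ v∉X λ v⇝ρ → ¬u⇝v (⇝-trans u⇝ρ (⇝-sym v⇝ρ))

  apex-column⊆X : ∀ i → ⟪ apex , i ⟫ ∈ X
  apex-column⊆X i = decidable-stable (⟪ apex , i ⟫ ∈? X) λ apex∉X → connected-after-cut (proj₁ X-good) apex∉X
    where
    has-clean-column? : ∀ c → Dec (∃ λ t → Clean (clique c t))
    has-clean-column? c = any? λ t → clean? (clique c t)
    blocked : ¬ (∃ λ t → Clean (clique c t)) → ∀ t → ∃ λ i → ⟪ clique c t , i ⟫ ∈ X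
    blocked no-clean t = ¬Clean⇒blocked λ clean → no-clean (t , clean)
    connected-after-cut : DisconnectedAfter Γ X → ⟪ apex , i ⟫ ∉ X → ⊥
    connected-after-cut (u , v , u∉X , v∉X , ¬u⇝v) apex∉X = via (has-clean-column? zero) (has-clean-column? (suc zero))
      where
      via : Dec (∃ λ t → Clean (clique zero t)) → Dec (∃ λ t → Clean (clique (suc zero) t)) → ⊥
      via (yes clean₀) (yes clean₁) =
        ¬u⇝v (BothCliquesClean.connected (λ { zero → clean₀ ; (suc zero) → clean₁ }) apex∉X u∉X v∉X)
      via (no no-clean₀) _              = BlockedClique.connected zero (blocked no-clean₀) u∉X v∉X ¬u⇝v
      via (yes _)        (no no-clean₁) = BlockedClique.connected (suc zero) (blocked no-clean₁) u∉X v∉X ¬u⇝v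

-- The lower bound

regroup : ∀ x k → x + ((k + k) + x) ≡ (x + k) + (x + k)
regroup = solve-∀

half : ∀ {a m} → a + a ≤ m + m → a ≤ m
half {a} {m} a+a≤m+m with a ≤? m
... | yes a≤m = a≤m
... | no  a≰m = contradiction a+a≤m+m (<⇒≱ (+-mono-< (≰⇒> a≰m) (≰⇒> a≰m)))

module SmallCutLowerBound (n′ : ℕ) (X : Subset (9 * (4 + n′))) (X-good : GoodNeighborCut (D 4 □ P (4 + n′)) 3 X)
                          (∣X∣≤5 : ∣ X ∣ ≤ 5) where

  open D₄□P (4 + n′)
  open Cut {4 + n′} X X-good
  open SmallCut X X-good (s≤s (s≤s (s≤s z≤n))) ∣X∣≤5

  4≤∣X∣ : 4 ≤ ∣ X ∣
  4≤∣X∣ = length≤∣p∣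
    ( (⟪⟫-≢ⁱ (λ ()) ∷ ⟪⟫-≢ⁱ (λ ()) ∷ ⟪⟫-≢ⁱ (λ ()) ∷ [])
    ∷ (⟪⟫-≢ⁱ (λ ()) ∷ ⟪⟫-≢ⁱ (λ ()) ∷ [])
    ∷ (⟪⟫-≢ⁱ (λ ()) ∷ [])
    ∷ [] ∷ [])
    (apex-column⊆X (# 0) ∷ apex-column⊆X (# 1) ∷ apex-column⊆X (# 2) ∷ apex-column⊆X (# 3) ∷ [])

  clean-column : ∀ c → ∃ λ b → Clean (clique c b)
  clean-column c = via (clean? (clique c (# 1))) (clean? (clique c (# 2)))
    where
    via : Dec (Clean (clique c (# 1))) → Dec (Clean (clique c (# 2))) → ∃ λ b → Clean (clique c b)
    via (yes clean) _           = # 1 , clean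
    via (no _)      (yes clean) = # 2 , clean
    via (no dirty₁) (no dirty₂) =
      let (i₁ , ∈X₁) = ¬Clean⇒blocked dirty₁ ; (i₂ , ∈X₂) = ¬Clean⇒blocked dirty₂ in
      ⊥-elim (over-budget
        ( (clique-cells-≢ (λ ()) ∷ ⟪⟫-≢ˣ (λ ()) ∷ ⟪⟫-≢ˣ (λ ()) ∷ ⟪⟫-≢ˣ (λ ()) ∷ ⟪⟫-≢ˣ (λ ()) ∷ [])
        ∷ (⟪⟫-≢ˣ (λ ()) ∷ ⟪⟫-≢ˣ (λ ()) ∷ ⟪⟫-≢ˣ (λ ()) ∷ ⟪⟫-≢ˣ (λ ()) ∷ [])
        ∷ (⟪⟫-≢ⁱ (λ ()) ∷ ⟪⟫-≢ⁱ (λ ()) ∷ ⟪⟫-≢ⁱ (λ ()) ∷ [])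
        ∷ (⟪⟫-≢ⁱ (λ ()) ∷ ⟪⟫-≢ⁱ (λ ()) ∷ [])
        ∷ (⟪⟫-≢ⁱ (λ ()) ∷ [])
        ∷ [] ∷ [])
        (∈X₁ ∷ ∈X₂ ∷ apex-column⊆X (# 0) ∷ apex-column⊆X (# 1) ∷ apex-column⊆X (# 2) ∷ apex-column⊆X (# 3) ∷ []))

  clique-band⊆C∪X : ∀ {C} → Component Γ X C → ∃ λ c → ∀ t i → ⟪ clique c t , i ⟫ ∈ C ∪ X
  clique-band⊆C∪X {C} (u , u∉X , C≡reach) = via (coordinates u) u∉X C≡reach
    where
    via : ∀ {u} → Coordinates u → u ∉ X → (∀ v → v ∈ C ⇔ (u ⇝ v)) → ∃ λ c → ∀ t i → ⟪ clique c t , i ⟫ ∈ C ∪ X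
    via (at apex i)          u∉X _       = contradiction (apex-column⊆X i) u∉X
    via (at (clique c s) i) u∉X C≡reach = c , λ t j → cell t j (⟪ clique c t , j ⟫ ∈? X)
      where
      b : Fin 4
      b = proj₁ (clean-column c)
      b-clean : Clean (clique c b)
      b-clean = proj₂ (clean-column c)
      cell : ∀ t j → Dec (⟪ clique c t , j ⟫ ∈ X) → ⟪ clique c t , j ⟫ ∈ C ∪ X
      cell t j (yes ∈X) = x∈p∪q⁺ (inj₂ ∈X)
      cell t j (no ∉X)  = x∈p∪q⁺ (inj₁ (from (C≡reach _)
        (⇝-trans (⇝-clean-column b-clean u∉X j) (⇝-sym (⇝-clean-column b-clean ∉X j)))))

  16≤∣C∪X∣ : ∀ {C} → Component Γ X C → 16 ≤ ∣ C ∪ X ∣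
  16≤∣C∪X∣ {C} C-comp = subst (_≤ ∣ C ∪ X ∣) (length-tabulate cell)
    (length≤∣p∣ (Unique.tabulate⁺ cell-injective) (Allₚ.tabulate⁺ λ a → band (column a) (layer a)))
    where
    c : Fin 2
    c = proj₁ (clique-band⊆C∪X C-comp)
    band : ∀ t i → ⟪ clique c t , i ⟫ ∈ C ∪ X
    band = proj₂ (clique-band⊆C∪X C-comp)
    column : Fin 16 → Fin 4
    column a = proj₁ (remQuot {4} 4 a)
    layer : Fin 16 → Fin (4 + n′)
    layer a = proj₂ (remQuot {4} 4 a) ↑ˡ n′
    cell : Fin 16 → Vertex
    cell a = ⟪ clique c (column a) , layer a ⟫
    cell-injective : ∀ {a a′} → cell a ≡ cell a′ → a ≡ a′
    cell-injective {a} {a′} eq =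
      let (same-clique , same-layer) = ⟪⟫-injective eq in
      trans (sym (combine-remQuot {4} 4 a))
        (trans (cong₂ combine (proj₂ (clique-injective same-clique)) (↑ˡ-injective n′ _ _ same-layer))
               (combine-remQuot {4} 4 a′))

  small-cut-bound : ∀ {C k} → Component Γ X C → CompVal Γ 3 C k → 10 ≤ ∣ X ∣ + k
  small-cut-bound {C} {k} C-comp C-val = half (begin
    4 + 16                       ≤⟨ +-mono-≤ 4≤∣X∣ (16≤∣C∪X∣ C-comp) ⟩
    ∣ X ∣ + ∣ C ∪ X ∣             ≤⟨ +-monoʳ-≤ ∣ X ∣ (∣p∪q∣≤∣p∣+∣q∣ C X) ⟩
    ∣ X ∣ + (∣ C ∣ + ∣ X ∣)       ≤⟨ +-monoʳ-≤ ∣ X ∣ (+-monoˡ-≤ ∣ X ∣ (∣C∣≤k+k C-val)) ⟩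
    ∣ X ∣ + ((k + k) + ∣ X ∣)     ≡⟨ regroup ∣ X ∣ k ⟩
    (∣ X ∣ + k) + (∣ X ∣ + k)     ∎)
    where open ≤-Reasoning

gc-lower-bound : ∀ n′ {X k} → GoodNeighborCut (D 4 □ P (4 + n′)) 3 X → MinAC (D 4 □ P (4 + n′)) 3 X k → 10 ≤ ∣ X ∣ + k
gc-lower-bound n′ {X} {k} X-good ((C , C-comp , C-val) , _) = via (6 ≤? ∣ X ∣)
  where
  open D₄□P (4 + n′)
  via : Dec (6 ≤ ∣ X ∣) → 10 ≤ ∣ X ∣ + k
  via (yes 6≤∣X∣) = +-mono-≤ 6≤∣X∣ (compVal⇒g<k (proj₂ X-good) C-comp C-val)
  via (no  6≰∣X∣) = SmallCutLowerBound.small-cut-bound n′ X X-good (≤-pred (≰⇒> 6≰∣X∣)) C-comp C-val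

-- A cut attaining the bound

module UpperBound (n′ : ℕ) where

  open D₄□P (4 + n′)

  private
    variable
      c : Fin 2
      t : Fin 4
      i : Fin (4 + n′)
      v w : Vertex

  row : Fin (4 + n′) → List Vertex
  row i = tabulate λ t → ⟪ clique zero t , i ⟫

  X₀-list : List Vertex
  X₀-list = row (# 1) ++ ⟪ apex , # 0 ⟫ ∷ ⟪ apex , # 1 ⟫ ∷ []

  X₀ : Subset (9 * (4 + n′))
  X₀ = fromList X₀-list

  C₀ : Subset (9 * (4 + n′))
  C₀ = fromList (row (# 0))

  ∈row : ∀ t → ⟪ clique zero t , i ⟫ ∈ₗ row i
  ∈row {i} = ∈-tabulate⁺ {f = λ t → ⟪ clique zero t , i ⟫}

  row₁⊆X₀ : ∀ t → ⟪ clique zero t , # 1 ⟫ ∈ X₀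
  row₁⊆X₀ t = ∈-fromList⁺ X₀-list (∈-++⁺ˡ (∈row t))

  apex₀∈X₀ : ⟪ apex , # 0 ⟫ ∈ X₀
  apex₀∈X₀ = ∈-fromList⁺ X₀-list (∈-++⁺ʳ (row (# 1)) (here refl))

  apex₁∈X₀ : ⟪ apex , # 1 ⟫ ∈ X₀
  apex₁∈X₀ = ∈-fromList⁺ X₀-list (∈-++⁺ʳ (row (# 1)) (there (here refl)))

  X₀-members : v ∈ X₀ → (∃ λ t → v ≡ ⟪ clique zero t , # 1 ⟫) ⊎ v ≡ ⟪ apex , # 0 ⟫ ⊎ v ≡ ⟪ apex , # 1 ⟫
  X₀-members v∈X₀ with ∈-++⁻ (row (# 1)) (∈-fromList⁻ X₀-list v∈X₀)
  ... | inj₁ v∈row               = inj₁ (∈-tabulate⁻ v∈row)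
  ... | inj₂ (here refl)         = inj₂ (inj₁ refl)
  ... | inj₂ (there (here refl)) = inj₂ (inj₂ refl)
  ... | inj₂ (there (there ()))

  clique-cell∉X₀ : (c ≡ zero → i ≢ # 1) → ⟪ clique c t , i ⟫ ∉ X₀
  clique-cell∉X₀ off-row₁ ∈X₀ with X₀-members ∈X₀
  ... | inj₁ (_ , eq) = let (same-clique , same-layer) = ⟪⟫-injective eq in
                         off-row₁ (proj₁ (clique-injective same-clique)) same-layer
  ... | inj₂ (inj₁ eq) = contradiction (proj₁ (⟪⟫-injective eq)) λ ()
  ... | inj₂ (inj₂ eq) = contradiction (proj₁ (⟪⟫-injective eq)) λ ()

  apex∉X₀ : 2 ≤ toℕ i → ⟪ apex , i ⟫ ∉ X₀
  apex∉X₀ 2≤i ∈X₀ with X₀-members ∈X₀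
  ... | inj₁ (_ , eq) = contradiction (proj₁ (⟪⟫-injective eq)) λ ()
  ... | inj₂ (inj₁ eq) = contradiction (subst (λ j → 2 ≤ toℕ j) (proj₂ (⟪⟫-injective eq)) 2≤i) λ ()
  ... | inj₂ (inj₂ eq) = contradiction (subst (λ j → 2 ≤ toℕ j) (proj₂ (⟪⟫-injective eq)) 2≤i) λ { (s≤s ()) }

  layer₀-neighbour : ∀ {k : Fin (4 + n′)} → Consecutive (# 0) k → k ≡ # 1
  layer₀-neighbour (inj₁ 1≡k) = toℕ-injective (sym 1≡k)

  reach-from-row₀ : Reach Γ (∁ X₀) ⟪ clique zero t , # 0 ⟫ w → ∃ λ t′ → w ≡ ⟪ clique zero t′ , # 0 ⟫
  reach-from-row₀ {t} (here _)                  = t , refl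
  reach-from-row₀     (step {w′} r w′~w w∈∁X₀) = via (reach-from-row₀ r) w′~w (x∈∁p⇒x∉p w∈∁X₀)
    where
    within-row : ∀ {s w} → Neighbour (clique zero s) (# 0) w → w ∉ X₀ → ∃ λ t′ → w ≡ ⟪ clique zero t′ , # 0 ⟫
    within-row {s} (vertical 0~k) w∉X₀ =
      contradiction (subst (λ k → ⟪ clique zero s , k ⟫ ∈ X₀) (sym (layer₀-neighbour 0~k)) (row₁⊆X₀ s)) w∉X₀
    within-row (horizontal (clique-edge _)) _    = _ , refl
    within-row (horizontal (hub-apex _))    w∉X₀ = contradiction apex₀∈X₀ w∉X₀
    via : ∀ {w′ w} → (∃ λ t′ → w′ ≡ ⟪ clique zero t′ , # 0 ⟫) → Adj Γ w′ w → w ∉ X₀ →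
          ∃ λ t′ → w ≡ ⟪ clique zero t′ , # 0 ⟫
    via (_ , refl) w′~w w∉X₀ = within-row (neighbour w′~w) w∉X₀

  row₀-free : ⟪ clique c t , # 0 ⟫ ∉ X₀
  row₀-free = clique-cell∉X₀ λ _ ()

  X₀-disconnects : DisconnectedAfter Γ X₀
  X₀-disconnects = ⟪ hub zero , # 0 ⟫ , ⟪ hub (suc zero) , # 0 ⟫ , row₀-free , row₀-free , λ r →
    contradiction (proj₁ (clique-injective (proj₁ (⟪⟫-injective (proj₂ (reach-from-row₀ r)))))) λ ()

  three-free-neighbours : ∀ {x i a b d} → Neighbour x i a → Neighbour x i b → Neighbour x i d →
                          a ≢ b → a ≢ d → b ≢ d → a ∉ X₀ → b ∉ X₀ → d ∉ X₀ → 3 ≤ ∣ nbhd Γ ⟪ x , i ⟫ ∩ ∁ X₀ ∣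
  three-free-neighbours {x} {i} x~a x~b x~d a≢b a≢d b≢d a∉X₀ b∉X₀ d∉X₀ =
    length≤∣p∣ ((a≢b ∷ a≢d ∷ []) ∷ (b≢d ∷ []) ∷ [] ∷ []) (free x~a a∉X₀ ∷ free x~b b∉X₀ ∷ free x~d d∉X₀ ∷ [])
    where
    free : ∀ {v} → Neighbour x i v → v ∉ X₀ → v ∈ nbhd Γ ⟪ x , i ⟫ ∩ ∁ X₀
    free {v} x~v v∉X₀ = x∈p∩q⁺ (Adj⇒∈nbhd {u = ⟪ x , i ⟫} {v = v} (Neighbour⇒Adj x~v) , x∉p⇒x∈∁p v∉X₀)

  free-apex⇒2≤layer : ⟪ apex , i ⟫ ∉ X₀ → 2 ≤ toℕ i
  free-apex⇒2≤layer {zero}             apex∉X₀ = contradiction apex₀∈X₀ apex∉X₀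
  free-apex⇒2≤layer {suc zero}         apex∉X₀ = contradiction apex₁∈X₀ apex∉X₀
  free-apex⇒2≤layer {suc (suc _)}      _       = s≤s (s≤s z≤n)

  X₀-minDeg : MinDegGE Γ (∁ X₀) 3
  X₀-minDeg w w∈∁X₀ = via (coordinates w) (x∈∁p⇒x∉p w∈∁X₀)
    where
    via : ∀ {w} → Coordinates w → w ∉ X₀ → 3 ≤ ∣ nbhd Γ w ∩ ∁ X₀ ∣
    via (at (clique c t) i) cell∉X₀ =
      let (a , b , d , a≢t , b≢t , d≢t , a≢b , a≢d , b≢d) = three-others t in
      three-free-neighbours (horizontal (clique-edge (≢-sym a≢t))) (horizontal (clique-edge (≢-sym b≢t)))
                            (horizontal (clique-edge (≢-sym d≢t)))
                            (clique-cells-≢ a≢b) (clique-cells-≢ a≢d) (clique-cells-≢ b≢d)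
                            (same-row∉X₀ a) (same-row∉X₀ b) (same-row∉X₀ d)
      where
      same-row∉X₀ : ∀ s → ⟪ clique c s , i ⟫ ∉ X₀
      same-row∉X₀ s = clique-cell∉X₀ λ { refl refl → cell∉X₀ (row₁⊆X₀ t) }
    via (at apex i) apex-i∉X₀ =
      let 2≤i = free-apex⇒2≤layer apex-i∉X₀
          (k , i~k , 2≤k) = far-neighbour (s≤s (s≤s (s≤s (s≤s z≤n)))) i 2≤i
          hub∉X₀ : ∀ c → ⟪ hub c , i ⟫ ∉ X₀
          hub∉X₀ c = clique-cell∉X₀ λ { _ refl → contradiction 2≤i λ { (s≤s ()) } }
      in three-free-neighbours (horizontal (apex-hub zero)) (horizontal (apex-hub (suc zero))) (vertical i~k)
                               (⟪⟫-≢ˣ λ ()) (⟪⟫-≢ˣ λ ()) (⟪⟫-≢ˣ λ ()) (hub∉X₀ zero) (hub∉X₀ (suc zero)) (apex∉X₀ 2≤k)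

  X₀-good : GoodNeighborCut Γ 3 X₀
  X₀-good = X₀-disconnects , X₀-minDeg

  C₀-component : Component Γ X₀ C₀
  C₀-component = ⟪ hub zero , # 0 ⟫ , row₀-free , λ v → mk⇔ (reachable v) (member v)
    where
    reach-row : ∀ t → Reach Γ (∁ X₀) ⟪ hub zero , # 0 ⟫ ⟪ clique zero t , # 0 ⟫
    reach-row t = via (t ≟ zero)
      where
      via : Dec (t ≡ zero) → Reach Γ (∁ X₀) ⟪ hub zero , # 0 ⟫ ⟪ clique zero t , # 0 ⟫
      via (yes refl) = here (x∉p⇒x∈∁p row₀-free)
      via (no t≢0)   = Reach-edge (x∉p⇒x∈∁p row₀-free) (Neighbour⇒Adj (horizontal (clique-edge (≢-sym t≢0))))
                                  (x∉p⇒x∈∁p row₀-free)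
    reachable : ∀ v → v ∈ C₀ → Reach Γ (∁ X₀) ⟪ hub zero , # 0 ⟫ v
    reachable v v∈C₀ =
      let (t , v≡cell) = ∈-tabulate⁻ {f = λ t → ⟪ clique zero t , # 0 ⟫} (∈-fromList⁻ (row (# 0)) v∈C₀) in
      subst (Reach Γ (∁ X₀) ⟪ hub zero , # 0 ⟫) (sym v≡cell) (reach-row t)
    member : ∀ v → Reach Γ (∁ X₀) ⟪ hub zero , # 0 ⟫ v → v ∈ C₀
    member v r = let (t , v≡cell) = reach-from-row₀ r in
      subst (_∈ C₀) (sym v≡cell) (∈-fromList⁺ (row (# 0)) (∈row t))

  ∣C₀∣≤4 : ∣ C₀ ∣ ≤ 4
  ∣C₀∣≤4 = ∣fromList∣≤length (row (# 0))

  ∣X₀∣≤6 : ∣ X₀ ∣ ≤ 6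
  ∣X₀∣≤6 = ∣fromList∣≤length X₀-list

  C₀-unsplittable : ¬ Splittable Γ 3 C₀
  C₀-unsplittable (_ , _ , split) = <-irrefl refl (≤-trans (Split⇒1+g<∣C∣ split) ∣C₀∣≤4)

  X₀-minAC : MinAC Γ 3 X₀ ∣ C₀ ∣
  X₀-minAC = (C₀ , C₀-component , inj₂ (C₀-unsplittable , refl)) ,
             λ C k C-comp C-val → ≤-trans ∣C₀∣≤4 (compVal⇒g<k X₀-minDeg C-comp C-val)

proposition5p1 : ∀ (n : ℕ) → 4 ≤ n → GCNumber (D 4 □ P n) 3 10
proposition5p1 (suc (suc (suc (suc n′)))) (s≤s (s≤s (s≤s (s≤s z≤n)))) =
  (X₀ , ∣ C₀ ∣ , X₀-good , X₀-minAC , ≤-antisym (gc-lower-bound n′ X₀-good X₀-minAC) (+-mono-≤ ∣X₀∣≤6 ∣C₀∣≤4)) ,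
  λ _ _ → gc-lower-bound n′
  where open UpperBound n′
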